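{- Let $Q(x,y)=Q_{\mathcal{T}}(x,y;t)$ be the complete generating function of quarter-plane walks with steps from $\mathcal{T}=\{(-1,1),(0,1),(1,-1)\}$. Then, as formal power series in $t$, $$Q(x,0)=\frac{1}{x^2t}\sum_{n\ge0}(-1)^nA_n(x)A_{n+1}(x),\qquad Q(0,y)=\frac{1}{y^2t}\sum_{n\ge0}(-1)^nB_n(y)B_{n+1}(y),$$ $$Q(1,1)=\frac{1}{1-3t}\left(1-\sum_{n\ge0}(-1)^nA_n(1)A_{n+1}(1)-\sum_{n\ge0}(-1)^nB_n(1)B_{n+1}(1)\right).$$
   Context: A walk in the quarter plane with step set $\mathcal{T}$ is a sequence of lattice points starting at $(0,0)$, all in $\mathbb{N}^2$, with consecutive differences in $\mathcal{T}$; $Q_{\mathcal{T}}(x,y;t)=\sum q_{n,i,j}x^iy^jt^n$ where $q_{n,i,j}$ counts such walks of length $n$ ending at $(i,j)$. Let $K(x,y)=xy-t(xy^2+x^2+y^2)$. Let $Y_1(x)=\frac{x}{2t(1+x)}\left(1-\sqrt{1-4t^2(1+x)}\right)$ be the root of $K(x,y)=0$ in $y$ that is a formal power series in $t$, and $X_1(y)=\frac{y}{2t}\left(1-ty-\sqrt{(1-ty)^2-4t^2}\right)$ the root of $K(x,y)=0$ in $x$ that is a formal power series in $t$. Define $A_0(x)=x$, $A_{2k+1}=Y_1(A_{2k})$, $A_{2k+2}=X_1(A_{2k+1})$, and $B_0(y)=y$, $B_{2k+1}=X_1(B_{2k})$, $B_{2k+2}=Y_1(B_{2k+1})$. -}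

module Defs where

open import Data.Nat as ℕ using (ℕ; zero; suc; _≤_; _∸_)
open import Data.Nat.Combinatorics using (_C_)
open import Data.Integer as ℤ using (ℤ; +_; -_)
open import Data.Bool using (Bool; true; false; if_then_else_)
open import Data.List using (List; []; _∷_; length; filter; concatMap; map)
open import Data.Product using (_×_; _,_; ∃-syntax)
open import Relation.Binary.PropositionalEquality using (_≡_)
open import Relation.Nullary using (Dec; yes; no)
open import Relation.Nullary.Decidable using (_×-dec_)
open import Data.Unit using (⊤; tt)
open import Data.Empty using (⊥)

sumTo : ℕ → (ℕ → ℤ) → ℤ
sumTo zero    f = + 0
sumTo (suc n) f = sumTo n f ℤ.+ f n

-- Formal power series in t whose coefficients are (polynomials / power
-- series) in one further variable z, over ℤ:
--   F n i  =  coefficient of  t^n z^i .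
-- (ℤ[z][[t]] embeds injectively into this ring ℤ[[z,t]].)

Ser : Set
Ser = ℕ → ℕ → ℤ

_⊕_ : Ser → Ser → Ser
(f ⊕ g) n i = f n i ℤ.+ g n i

_⊖_ : Ser → Ser → Ser
(f ⊖ g) n i = f n i ℤ.- g n i

_·_ : ℤ → Ser → Ser
(c · f) n i = c ℤ.* f n i

_⊗_ : Ser → Ser → Ser
(f ⊗ g) n i = sumTo (suc n) λ a → sumTo (suc i) λ b → f a b ℤ.* g (n ∸ a) (i ∸ b)

mono : ℕ → ℕ → Ser
mono m k n i with m ℕ.≟ n | k ℕ.≟ i
... | yes _ | yes _ = + 1
... | _     | _     = + 0

one : Ser
one = mono 0 0

zvar : Ser      -- the variable x (resp. y)
zvar = mono 0 1

tvar : Ser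
tvar = mono 1 0

_^^_ : Ser → ℕ → Ser
f ^^ zero  = one
f ^^ suc k = f ⊗ (f ^^ k)

catalan : ℕ → ℕ
catalan k = ((2 ℕ.* k) C k) ℕ./ suc k

-- The roots Y₁ and X₁ of K(x,y) = xy - t(xy² + x² + y²), substituted
-- into a series G.  They are the t-expansions of the closed forms
--   Y₁(x) = x/(2t(1+x)) (1 - √(1-4t²(1+x)))
--         = Σ_{k≥0} Cat_k t^{2k+1} x (1+x)^k ,
--   X₁(y) = y/(2t) (1 - ty - √((1-ty)² - 4t²))
--         = Σ_{k≥0} Cat_k t^{2k+1} y (1-ty)^{-(2k+1)}
--         = Σ_{k,j≥0} Cat_k binom(2k+j, j) t^{2k+1+j} y^{j+1} .
-- At the coefficient of t^n only terms with 2k+1(+j) ≤ n contribute, so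
-- truncating the sums at k, j ≤ n is exact.

Y₁ : Ser → Ser
Y₁ G n i = sumTo (suc n) (λ k →
  ((+ catalan k) · (mono (suc (2 ℕ.* k)) 0 ⊗ (G ⊗ ((one ⊕ G) ^^ k)))) n i)

X₁ : Ser → Ser
X₁ G n i = sumTo (suc n) (λ k → sumTo (suc n) (λ j →
  ((+ (catalan k ℕ.* ((2 ℕ.* k ℕ.+ j) C j)))
     · (mono (suc (2 ℕ.* k ℕ.+ j)) 0 ⊗ (G ^^ suc j))) n i))

even : ℕ → Bool
even zero          = true
even (suc zero)    = false
even (suc (suc n)) = even n

A : Ser → ℕ → Ser
A c zero    = c
A c (suc n) = if even n then Y₁ (A c n) else X₁ (A c n)

B : Ser → ℕ → Ser
B c zero    = c
B c (suc n) = if even n then X₁ (B c n) else Y₁ (B c n)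

altPartial : (ℕ → Ser) → ℕ → Ser
altPartial S zero    = λ _ _ → + 0
altPartial S (suc m) =
  if even m then altPartial S m ⊕ (S m ⊗ S (suc m))
            else altPartial S m ⊖ (S m ⊗ S (suc m))

Converges : (ℕ → Ser) → Ser → Set
Converges P L = ∀ n i → ∃[ M ] (∀ m → M ≤ m → P m n i ≡ L n i)

data Step : Set where
  nw n se : Step

Δ : Step → ℤ × ℤ
Δ nw = (- + 1 , + 1)
Δ n  = (+ 0 , + 1)
Δ se = (+ 1 , - + 1)

allWalks : ℕ → List (List Step)
allWalks zero    = [] ∷ []
allWalks (suc k) = concatMap (λ w → (nw ∷ w) ∷ (n ∷ w) ∷ (se ∷ w) ∷ []) (allWalks k)

StaysIn : ℤ × ℤ → List Step → Set
StaysIn p [] = ⊤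
StaysIn (a , b) (s ∷ w) with Δ s
... | (da , db) = ((+ 0 ℤ.≤ a ℤ.+ da) × (+ 0 ℤ.≤ b ℤ.+ db)) × StaysIn (a ℤ.+ da , b ℤ.+ db) w

staysIn? : ∀ p w → Dec (StaysIn p w)
staysIn? p [] = yes tt
staysIn? (a , b) (s ∷ w) with Δ s
... | (da , db) = ((+ 0 ℤ.≤? a ℤ.+ da) ×-dec (+ 0 ℤ.≤? b ℤ.+ db)) ×-dec staysIn? (a ℤ.+ da , b ℤ.+ db) w

endpoint : ℤ × ℤ → List Step → ℤ × ℤ
endpoint p [] = p
endpoint (a , b) (s ∷ w) with Δ s
... | (da , db) = endpoint (a ℤ.+ da , b ℤ.+ db) w

qpWalks : ℕ → List (List Step)
qpWalks k = filter (staysIn? (+ 0 , + 0)) (allWalks k)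

EndsAt : ℕ → ℕ → List Step → Set
EndsAt i j w = endpoint (+ 0 , + 0) w ≡ (+ i , + j)

endsAt? : ∀ i j w → Dec (EndsAt i j w)
endsAt? i j w with endpoint (+ 0 , + 0) w
... | (a , b) with a ℤ.≟ + i | b ℤ.≟ + j
... | yes p | yes q = yes (Relation.Binary.PropositionalEquality.cong₂ _,_ p q)
... | no ¬p | _     = no λ e → ¬p (Relation.Binary.PropositionalEquality.cong Data.Product.proj₁ e)
... | _     | no ¬q = no λ e → ¬q (Relation.Binary.PropositionalEquality.cong Data.Product.proj₂ e)

q : ℕ → ℕ → ℕ → ℕ
q k i j = length (filter (endsAt? i j) (qpWalks k))

Qx0 : Ser
Qx0 k i = + q k i 0

Q0y : Ser
Q0y k j = + q k 0 j

Q11 : Ser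
Q11 k zero    = + length (qpWalks k)
Q11 k (suc _) = + 0

{-# OPTIONS --safe #-}
-- The kernel method.  Removing the last step of a walk gives, for the kernel
-- K(x,y) = xy − t(xy² + x² + y²), the equation K(x,y) Q(x,y) = xy − F(x) − G(y)
-- with F(x) = t x² Q(x,0) and G(y) = t y² Q(0,y); it holds as an identity of
-- t-adic series after substituting any series u, v for x, y.  With C(s) the
-- Catalan series, C = 1 + s C², the closed forms Y₁(x) = t x C(t²(1+x)) and
-- X₁(y) = y τ C(τ²), τ = t/(1 − ty), make Y₁ and X₁ roots of K, so that
-- uv = F(u) + G(v) whenever v = Y₁(u) or u = X₁(v).  Consequently
-- A_n A_{n+1} is F(A_n) + G(A_{n+1}) or G(A_n) + F(A_{n+1}) according to the
-- parity of n, and the alternating sum telescopes to F(A₀) up to a remainder of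
-- t-order at least n; likewise for B.  At x = y = 1 the kernel equation itself reads
-- (1 − 3t) Q(1,1) = 1 − F(1) − G(1).

module Submission where

open import Algebra using (CommutativeRing; IsCommutativeRing)
import Algebra.Solver.Ring.AlmostCommutativeRing as ACR
open import Data.Bool using (Bool; true; false; if_then_else_; not; _∧_)
open import Data.Bool.Properties using (not-involutive; ∧-zeroʳ)
open import Data.Empty using (⊥-elim)
open import Data.Integer as ℤ using (ℤ; +_; -[1+_])
import Data.Integer.Properties as ℤP
import Data.Integer.Tactic.RingSolver as ℤ-Solver
open import Data.List using (List; []; _∷_; map; concatMap; filter; length)
import Data.List.Properties as ListP
open import Data.Maybe using (Maybe; just; nothing)
open import Data.Nat as ℕ using (ℕ; zero; suc; _∸_; _<_; _≤_; z≤n; s≤s)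
open import Data.Nat.Combinatorics using (_C_; nCk+nC[k+1]≡[n+1]C[k+1]; nC1≡n; nCk≡nC[n∸k]; nCn≡1)
open import Data.Nat.DivMod using (_/_; m*n/n≡m)
open import Data.Nat.ListAction using (sum)
open import Data.Nat.ListAction.Properties using (sum-++)
import Data.Nat.Properties as ℕP
import Data.Nat.Tactic.RingSolver as ℕ-Solver
open import Data.Product using (_×_; _,_; proj₁; proj₂; Σ-syntax)
open import Data.Sum using (_⊎_; inj₁; inj₂)
open import Function using (_∘_)
open import Level using (0ℓ)
open import Relation.Binary.PropositionalEquality as ≡ using (_≡_; _≢_; refl)
import Relation.Binary.Reasoning.Setoid
open import Relation.Nullary using (Dec; yes; no; does)
open import Relation.Nullary.Decidable using (_×-dec_)
open import Relation.Unary using (Pred; Decidable)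

open import Defs renaming (n to north)

-- Finite sums and power series over a commutative ring

module FiniteSums {c ℓ} (R : CommutativeRing c ℓ) where

  open CommutativeRing R renaming (refl to ≈-refl)
  open import Algebra.Properties.CommutativeSemigroup +-commutativeSemigroup using (interchange)
  open import Algebra.Properties.Ring ring using (-0#≈0#; -‿+-comm)
  open import Relation.Binary.Reasoning.Setoid setoid

  Σ< : ℕ → (ℕ → Carrier) → Carrier
  Σ< zero    f = 0#
  Σ< (suc n) f = Σ< n f + f n

  Σ<-cong< : ∀ n {f g} → (∀ k → k < n → f k ≈ g k) → Σ< n f ≈ Σ< n g
  Σ<-cong< zero    f≈g = ≈-refl
  Σ<-cong< (suc n) f≈g = +-cong (Σ<-cong< n (λ k k<n → f≈g k (ℕP.m<n⇒m<1+n k<n))) (f≈g n (ℕP.n<1+n n))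

  Σ<-cong : ∀ n {f g} → (∀ k → f k ≈ g k) → Σ< n f ≈ Σ< n g
  Σ<-cong n f≈g = Σ<-cong< n (λ k _ → f≈g k)

  Σ<-zero : ∀ n f → (∀ k → k < n → f k ≈ 0#) → Σ< n f ≈ 0#
  Σ<-zero n f f≈0 = trans (Σ<-cong< n f≈0) (Σ0≈0 n)
    where
    Σ0≈0 : ∀ n → Σ< n (λ _ → 0#) ≈ 0#
    Σ0≈0 zero    = ≈-refl
    Σ0≈0 (suc n) = trans (+-identityʳ _) (Σ0≈0 n)

  Σ<-+ : ∀ n f g → Σ< n (λ k → f k + g k) ≈ Σ< n f + Σ< n g
  Σ<-+ zero    f g = sym (+-identityˡ 0#)
  Σ<-+ (suc n) f g = trans (+-congʳ (Σ<-+ n f g)) (interchange _ _ _ _)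

  *-distribˡ-Σ< : ∀ n a f → a * Σ< n f ≈ Σ< n (λ k → a * f k)
  *-distribˡ-Σ< zero    a f = zeroʳ a
  *-distribˡ-Σ< (suc n) a f = trans (distribˡ a _ _) (+-congʳ (*-distribˡ-Σ< n a f))

  *-distribʳ-Σ< : ∀ n a f → Σ< n f * a ≈ Σ< n (λ k → f k * a)
  *-distribʳ-Σ< zero    a f = zeroˡ a
  *-distribʳ-Σ< (suc n) a f = trans (distribʳ a _ _) (+-congʳ (*-distribʳ-Σ< n a f))

  -‿distrib-Σ< : ∀ n f → - Σ< n f ≈ Σ< n (λ k → - f k)
  -‿distrib-Σ< zero    f = -0#≈0#
  -‿distrib-Σ< (suc n) f = trans (sym (-‿+-comm _ _)) (+-congʳ (-‿distrib-Σ< n f))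

  Σ<-head : ∀ n f → Σ< (suc n) f ≈ f 0 + Σ< n (f ∘ suc)
  Σ<-head zero    f = trans (+-identityˡ _) (sym (+-identityʳ _))
  Σ<-head (suc n) f = trans (+-congʳ (Σ<-head n f)) (+-assoc _ _ _)

  Σ<-reverse : ∀ n f → Σ< (suc n) f ≈ Σ< (suc n) (λ k → f (n ∸ k))
  Σ<-reverse zero    f = ≈-refl
  Σ<-reverse (suc n) f = begin
    Σ< (suc (suc n)) f                          ≈⟨ Σ<-head (suc n) f ⟩
    f 0 + Σ< (suc n) (f ∘ suc)                  ≈⟨ +-comm _ _ ⟩
    Σ< (suc n) (f ∘ suc) + f 0                  ≈⟨ +-congʳ (Σ<-reverse n (f ∘ suc)) ⟩
    Σ< (suc n) (λ k → f (suc (n ∸ k))) + f 0    ≈⟨ +-cong (Σ<-cong< (suc n) shift) (reflexive (≡.cong f (≡.sym (ℕP.n∸n≡0 n)))) ⟩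
    Σ< (suc (suc n)) (λ k → f (suc n ∸ k))      ∎
    where
    shift : ∀ k → k < suc n → f (suc (n ∸ k)) ≈ f (suc n ∸ k)
    shift k k<1+n = reflexive (≡.cong f (≡.sym (ℕP.+-∸-assoc 1 (ℕP.≤-pred k<1+n))))

  Σ<-truncate : ∀ m n f → m ≤ n → (∀ k → m ≤ k → k < n → f k ≈ 0#) → Σ< n f ≈ Σ< m f
  Σ<-truncate m zero    f z≤n f≈0 = ≈-refl
  Σ<-truncate m (suc n) f m≤1+n f≈0 with m ℕ.≟ suc n
  ... | yes refl = ≈-refl
  ... | no m≢1+n = trans (+-cong (Σ<-truncate m n f m≤n (λ k m≤k k<n → f≈0 k m≤k (ℕP.m<n⇒m<1+n k<n)))
                                 (f≈0 n m≤n (ℕP.n<1+n n)))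
                         (+-identityʳ _)
    where m≤n = ℕP.≤-pred (ℕP.≤∧≢⇒< m≤1+n m≢1+n)

  Σ<-single : ∀ n m f → m < n → (∀ k → k < n → k ≢ m → f k ≈ 0#) → Σ< n f ≈ f m
  Σ<-single (suc n) m f m<1+n f≈0 with m ℕ.≟ n
  ... | yes refl = trans (+-congʳ (Σ<-zero n f (λ k k<n → f≈0 k (ℕP.m<n⇒m<1+n k<n) (ℕP.<⇒≢ k<n)))) (+-identityˡ _)
  ... | no m≢n   = trans (+-cong (Σ<-single n m f (ℕP.≤∧≢⇒< (ℕP.≤-pred m<1+n) m≢n) (λ k k<n → f≈0 k (ℕP.m<n⇒m<1+n k<n)))
                                 (f≈0 n (ℕP.n<1+n n) (m≢n ∘ ≡.sym)))
                         (+-identityʳ _)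

  Σ<-triangle : ∀ n (F : ℕ → ℕ → Carrier) →
                Σ< (suc n) (λ c → Σ< (suc c) (λ a → F a c)) ≈
                Σ< (suc n) (λ a → Σ< (suc (n ∸ a)) (λ b → F a (a ℕ.+ b)))
  Σ<-triangle zero    F = ≈-refl
  Σ<-triangle (suc n) F = begin
    Σ< (suc n) (λ c → Σ< (suc c) (λ a → F a c)) + (Σ< (suc n) (λ a → F a (suc n)) + F (suc n) (suc n))
      ≈⟨ +-congʳ (Σ<-triangle n F) ⟩
    Σ< (suc n) row + (Σ< (suc n) (λ a → F a (suc n)) + F (suc n) (suc n))
      ≈⟨ sym (+-assoc _ _ _) ⟩
    (Σ< (suc n) row + Σ< (suc n) (λ a → F a (suc n))) + F (suc n) (suc n)
      ≈⟨ +-cong (sym (Σ<-+ (suc n) _ _)) lastCell ⟩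
    Σ< (suc n) (λ a → row a + F a (suc n)) + Σ< (suc (suc n ∸ suc n)) (λ b → F (suc n) (suc n ℕ.+ b))
      ≈⟨ +-congʳ (Σ<-cong< (suc n) extendRow) ⟩
    Σ< (suc (suc n)) (λ a → Σ< (suc (suc n ∸ a)) (λ b → F a (a ℕ.+ b))) ∎
    where
    row : ℕ → Carrier
    row a = Σ< (suc (n ∸ a)) (λ b → F a (a ℕ.+ b))
    lastCell : F (suc n) (suc n) ≈ Σ< (suc (suc n ∸ suc n)) (λ b → F (suc n) (suc n ℕ.+ b))
    lastCell rewrite ℕP.n∸n≡0 n | ℕP.+-identityʳ n = sym (+-identityˡ _)
    extendRow : ∀ a → a < suc n → row a + F a (suc n) ≈ Σ< (suc (suc n ∸ a)) (λ b → F a (a ℕ.+ b))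
    extendRow a a<1+n rewrite ℕP.+-∸-assoc 1 (ℕP.≤-pred a<1+n)
      = +-congˡ (reflexive (≡.cong (F a) (≡.sym (≡.trans (ℕP.+-suc a (n ∸ a)) (≡.cong suc (ℕP.m+[n∸m]≡n (ℕP.≤-pred a<1+n)))))))

module PowerSeries {c ℓ} (R : CommutativeRing c ℓ) where

  open CommutativeRing R hiding (isCommutativeRing) renaming (refl to ≈-refl)
  open FiniteSums R
  open import Relation.Binary.Reasoning.Setoid setoid

  Series : Set c
  Series = ℕ → Carrier

  infix  4 _≋_
  infixl 6 _+ₛ_
  infixl 7 _*ₛ_

  _≋_ : Series → Series → Set ℓ
  f ≋ g = ∀ n → f n ≈ g n

  _+ₛ_ : Series → Series → Series
  (f +ₛ g) n = f n + g n

  -ₛ_ : Series → Series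
  (-ₛ f) n = - f n

  0ₛ : Series
  0ₛ _ = 0#

  1ₛ : Series
  1ₛ zero    = 1#
  1ₛ (suc _) = 0#

  _*ₛ_ : Series → Series → Series
  (f *ₛ g) n = Σ< (suc n) (λ a → f a * g (n ∸ a))

  *ₛ-cong : ∀ {f f′ g g′} → f ≋ f′ → g ≋ g′ → f *ₛ g ≋ f′ *ₛ g′
  *ₛ-cong f≋f′ g≋g′ n = Σ<-cong (suc n) (λ a → *-cong (f≋f′ a) (g≋g′ (n ∸ a)))

  *ₛ-comm : ∀ f g → f *ₛ g ≋ g *ₛ f
  *ₛ-comm f g n = trans (Σ<-reverse n _) (Σ<-cong< (suc n) swap)
    where
    swap : ∀ a → a < suc n → f (n ∸ a) * g (n ∸ (n ∸ a)) ≈ g a * f (n ∸ a)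
    swap a a<1+n rewrite ℕP.m∸[m∸n]≡n (ℕP.≤-pred a<1+n) = *-comm _ _

  *ₛ-assoc : ∀ f g h → (f *ₛ g) *ₛ h ≋ f *ₛ (g *ₛ h)
  *ₛ-assoc f g h n = begin
    Σ< (suc n) (λ c → Σ< (suc c) (λ a → f a * g (c ∸ a)) * h (n ∸ c))
      ≈⟨ Σ<-cong (suc n) (λ c → *-distribʳ-Σ< (suc c) _ _) ⟩
    Σ< (suc n) (λ c → Σ< (suc c) (λ a → f a * g (c ∸ a) * h (n ∸ c)))
      ≈⟨ Σ<-triangle n (λ a c → f a * g (c ∸ a) * h (n ∸ c)) ⟩
    Σ< (suc n) (λ a → Σ< (suc (n ∸ a)) (λ b → f a * g (a ℕ.+ b ∸ a) * h (n ∸ (a ℕ.+ b))))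
      ≈⟨ Σ<-cong (suc n) (λ a → Σ<-cong (suc (n ∸ a)) (λ b → reassociate a b)) ⟩
    Σ< (suc n) (λ a → Σ< (suc (n ∸ a)) (λ b → f a * (g b * h (n ∸ a ∸ b))))
      ≈⟨ Σ<-cong (suc n) (λ a → sym (*-distribˡ-Σ< (suc (n ∸ a)) _ _)) ⟩
    Σ< (suc n) (λ a → f a * Σ< (suc (n ∸ a)) (λ b → g b * h (n ∸ a ∸ b))) ∎
    where
    reassociate : ∀ a b → f a * g (a ℕ.+ b ∸ a) * h (n ∸ (a ℕ.+ b)) ≈ f a * (g b * h (n ∸ a ∸ b))
    reassociate a b rewrite ℕP.m+n∸m≡n a b | ℕP.∸-+-assoc n a b = *-assoc _ _ _

  *ₛ-distribˡ : ∀ f g h → f *ₛ (g +ₛ h) ≋ f *ₛ g +ₛ f *ₛ h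
  *ₛ-distribˡ f g h n = trans (Σ<-cong (suc n) (λ a → distribˡ _ _ _)) (Σ<-+ (suc n) _ _)

  *ₛ-distribʳ : ∀ f g h → (g +ₛ h) *ₛ f ≋ g *ₛ f +ₛ h *ₛ f
  *ₛ-distribʳ f g h n = trans (Σ<-cong (suc n) (λ a → distribʳ _ _ _)) (Σ<-+ (suc n) _ _)

  *ₛ-identityˡ : ∀ f → 1ₛ *ₛ f ≋ f
  *ₛ-identityˡ f n = begin
    Σ< (suc n) (λ a → 1ₛ a * f (n ∸ a))              ≈⟨ Σ<-head n _ ⟩
    1# * f n + Σ< n (λ a → 0# * f (n ∸ suc a))      ≈⟨ +-cong (*-identityˡ _) (Σ<-zero n _ (λ k _ → zeroˡ _)) ⟩
    f n + 0#                                         ≈⟨ +-identityʳ _ ⟩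
    f n                                              ∎

  *ₛ-identityʳ : ∀ f → f *ₛ 1ₛ ≋ f
  *ₛ-identityʳ f n = trans (*ₛ-comm f 1ₛ n) (*ₛ-identityˡ f n)

  isCommutativeRing : IsCommutativeRing _≋_ _+ₛ_ _*ₛ_ -ₛ_ 0ₛ 1ₛ
  isCommutativeRing = record
    { isRing = record
      { +-isAbelianGroup = record
        { isGroup = record
          { isMonoid = record
            { isSemigroup = record
              { isMagma = record
                { isEquivalence = record
                  { refl  = λ _ → ≈-refl
                  ; sym   = λ f≋g n → sym (f≋g n)
                  ; trans = λ f≋g g≋h n → trans (f≋g n) (g≋h n)
                  }
                ; ∙-cong = λ f≋f′ g≋g′ n → +-cong (f≋f′ n) (g≋g′ n)
                }
              ; assoc = λ _ _ _ _ → +-assoc _ _ _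
              }
            ; identity = (λ _ _ → +-identityˡ _) , (λ _ _ → +-identityʳ _)
            }
          ; inverse = (λ _ _ → -‿inverseˡ _) , (λ _ _ → -‿inverseʳ _)
          ; ⁻¹-cong = λ f≋g n → -‿cong (f≋g n)
          }
        ; comm = λ _ _ _ → +-comm _ _
        }
      ; *-cong     = *ₛ-cong
      ; *-assoc    = *ₛ-assoc
      ; *-identity = *ₛ-identityˡ , *ₛ-identityʳ
      ; distrib    = *ₛ-distribˡ , *ₛ-distribʳ
      }
    ; *-comm = *ₛ-comm
    }

  commutativeRing : CommutativeRing c ℓ
  commutativeRing = record { isCommutativeRing = isCommutativeRing }

-- Polynomial identities of the kernel method

module IntegerRingSolver {r₁ r₂} (R : ACR.AlmostCommutativeRing r₁ r₂)
  (ι : CommutativeRing.rawRing ℤP.+-*-commutativeRing ACR.-Raw-AlmostCommutative⟶ R) where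

  open ACR.AlmostCommutativeRing R using (_≈_) renaming (refl to ≈-refl)
  open ACR._-Raw-AlmostCommutative⟶_ ι using (⟦_⟧)

  private
    ι-≟ : ∀ a b → Maybe (⟦ a ⟧ ≈ ⟦ b ⟧)
    ι-≟ a b with a ℤ.≟ b
    ... | yes refl = just ≈-refl
    ... | no _     = nothing

  open import Algebra.Solver.Ring (CommutativeRing.rawRing ℤP.+-*-commutativeRing) R ι ι-≟ public


-- Stated over an abstract ring: normalising these polynomials directly in the
-- series ring below would make Agda unfold the Cauchy products when it compares
-- the normal forms.
module KernelIdentities {r₁ r₂} (R : ACR.AlmostCommutativeRing r₁ r₂)
  (ι : CommutativeRing.rawRing ℤP.+-*-commutativeRing ACR.-Raw-AlmostCommutative⟶ R) where

  open ACR.AlmostCommutativeRing R renaming (refl to ≈-refl)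
  open ACR._-Raw-AlmostCommutative⟶_ ι using (1-homo)
  open IntegerRingSolver R ι
  open import Relation.Binary.Reasoning.Setoid setoid

  kernel : Carrier → Carrier → Carrier → Carrier
  kernel t u v = u * v + - (t * (u * (v * v) + (u * u + v * v)))

  kernel-at-t*g*c : ∀ t g c → kernel t g (t * (g * c)) ≈ (t * (g * g)) * (c + - (1# + ((t * t) * (1# + g)) * (c * c)))
  kernel-at-t*g*c t g c = trans
    (solve 3 (λ t g c →
         g :* (t :* (g :* c)) :+ :- (t :* (g :* ((t :* (g :* c)) :* (t :* (g :* c))) :+ (g :* g :+ (t :* (g :* c)) :* (t :* (g :* c)))))
       := (t :* (g :* g)) :* (c :+ :- (con (+ 1) :+ ((t :* t) :* (con (+ 1) :+ g)) :* (c :* c)))) ≈-refl t g c)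
    (*-cong ≈-refl (+-cong ≈-refl (-‿cong (+-cong 1-homo (*-cong (*-cong ≈-refl (+-cong 1-homo ≈-refl)) ≈-refl)))))

  kernel-at-v*t*m*c : ∀ t v m c → kernel t (v * ((t * m) * c)) v ≈
    ((v * v) * t) * (c * ((1# + - (t * v)) * m + - 1#) + (c + - (1# + ((t * m) * (t * m)) * (c * c))))
  kernel-at-v*t*m*c t v m c = trans
    (solve 4 (λ t v m c →
         (v :* ((t :* m) :* c)) :* v :+ :- (t :* ((v :* ((t :* m) :* c)) :* (v :* v) :+ ((v :* ((t :* m) :* c)) :* (v :* ((t :* m) :* c)) :+ v :* v)))
       := ((v :* v) :* t) :* (c :* ((con (+ 1) :+ :- (t :* v)) :* m :+ :- con (+ 1)) :+ (c :+ :- (con (+ 1) :+ ((t :* m) :* (t :* m)) :* (c :* c))))) ≈-refl t v m c)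
    (*-cong ≈-refl (+-cong (*-cong ≈-refl (+-cong (*-cong (+-cong 1-homo ≈-refl) ≈-refl) (-‿cong 1-homo)))
                           (+-cong ≈-refl (-‿cong (+-cong 1-homo ≈-refl)))))

  kernel-at-1# : ∀ t → kernel t 1# 1# ≈ 1# + - (t * (1# + (1# + 1#)))
  kernel-at-1# t = +-cong (*-identityˡ 1#) (-‿cong (*-cong ≈-refl
    (+-cong (trans (*-identityˡ _) (*-identityˡ 1#)) (+-cong (*-identityˡ 1#) (*-identityˡ 1#)))))

  kernel-root⇒product-split : ∀ t u v q F G → kernel t u v ≈ 0# → kernel t u v * q ≈ u * v + - F + - G → u * v ≈ F + G
  kernel-root⇒product-split t u v q F G K≈0 Kq≈ = begin
    u * v                          ≈⟨ solve 3 (λ x F G → x := (x :+ :- F :+ :- G) :+ (F :+ G)) ≈-refl (u * v) F G ⟩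
    (u * v + - F + - G) + (F + G)  ≈⟨ +-cong (trans (sym Kq≈) (trans (*-cong K≈0 ≈-refl) (zeroˡ q))) ≈-refl ⟩
    0# + (F + G)                   ≈⟨ +-identityˡ (F + G) ⟩
    F + G                          ∎

  kernel-equation : ∀ t u v q F G → u * v * q ≈ u * v + (t * (u * (v * v) + (u * u + v * v)) * q + - F + - G) →
                    kernel t u v * q ≈ u * v + - F + - G
  kernel-equation t u v q F G uvq≈ = begin
    kernel t u v * q                             ≈⟨ solve 3 (λ x y q → (x :+ :- y) :* q := x :* q :+ :- (y :* q)) ≈-refl (u * v) W q ⟩
    u * v * q + - (W * q)                        ≈⟨ +-cong uvq≈ ≈-refl ⟩
    u * v + (W * q + - F + - G) + - (W * q)      ≈⟨ solve 4 (λ x y F G → x :+ (y :+ :- F :+ :- G) :+ :- y := x :+ :- F :+ :- G) ≈-refl (u * v) (W * q) F G ⟩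
    u * v + - F + - G                            ∎
    where W = t * (u * (v * v) + (u * u + v * v))

  scaled-step : ∀ t τ u v Q₀ Q₁ F G →
    u * (v * Q₁) ≈ u * (v * (v * Q₀)) + (u * (u * Q₀) + v * (v * Q₀)) + - (v * (v * G)) + - (u * (u * F)) →
    u * v * ((t * τ) * Q₁) ≈ t * (u * (v * v) + (u * u + v * v)) * (τ * Q₀) + - ((t * (u * u)) * (τ * F)) + - ((t * (v * v)) * (τ * G))
  scaled-step t τ u v Q₀ Q₁ F G step = begin
    u * v * ((t * τ) * Q₁)   ≈⟨ solve 5 (λ u v t τ Q → u :* v :* ((t :* τ) :* Q) := (t :* τ) :* (u :* (v :* Q))) ≈-refl u v t τ Q₁ ⟩
    (t * τ) * (u * (v * Q₁)) ≈⟨ *-cong ≈-refl step ⟩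
    (t * τ) * (u * (v * (v * Q₀)) + (u * (u * Q₀) + v * (v * Q₀)) + - (v * (v * G)) + - (u * (u * F)))
                             ≈⟨ solve 7 (λ t τ u v Q₀ F G →
                                    (t :* τ) :* (u :* (v :* (v :* Q₀)) :+ (u :* (u :* Q₀) :+ v :* (v :* Q₀)) :+ :- (v :* (v :* G)) :+ :- (u :* (u :* F)))
                                 := t :* (u :* (v :* v) :+ (u :* u :+ v :* v)) :* (τ :* Q₀) :+ :- ((t :* (u :* u)) :* (τ :* F)) :+ :- ((t :* (v :* v)) :* (τ :* G)))
                                 ≈-refl t τ u v Q₀ F G ⟩
    t * (u * (v * v) + (u * u + v * v)) * (τ * Q₀) + - ((t * (u * u)) * (τ * F)) + - ((t * (v * v)) * (τ * G)) ∎

-- The ring ℤ[[z]][[t]] of bivariate series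

open FiniteSums ℤP.+-*-commutativeRing

sumTo≡Σ< : ∀ n f → sumTo n f ≡ Σ< n f
sumTo≡Σ< zero    f = refl
sumTo≡Σ< (suc n) f = ≡.cong (ℤ._+ f n) (sumTo≡Σ< n f)

module ℤ[[z]]      = PowerSeries ℤP.+-*-commutativeRing
module ℤ[[z]][[t]] = PowerSeries ℤ[[z]].commutativeRing

Σ<-coeff : ∀ N F i → FiniteSums.Σ< ℤ[[z]].commutativeRing N F i ≡ Σ< N (λ a → F a i)
Σ<-coeff zero    F i = refl
Σ<-coeff (suc N) F i = ≡.cong (ℤ._+ F N i) (Σ<-coeff N F i)

⊗-coeff : ∀ f g n i → (f ⊗ g) n i ≡ Σ< (suc n) (λ a → Σ< (suc i) (λ b → f a b ℤ.* g (n ∸ a) (i ∸ b)))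
⊗-coeff f g n i = ≡.trans (sumTo≡Σ< (suc n) _) (Σ<-cong (suc n) (λ a → sumTo≡Σ< (suc i) _))

infix 4 _≈_

-- A record rather than a function type, so that the two sides of an equation
-- are found by unification instead of by unfolding _⊗_.
record _≈_ (f g : Ser) : Set where
  constructor coeffs
  field coeff : ∀ n i → f n i ≡ g n i

open _≈_ public

neg : Ser → Ser
neg f n i = ℤ.- f n i

zeroS : Ser
zeroS _ _ = + 0

private
  module ℤzt = CommutativeRing ℤ[[z]][[t]].commutativeRing

  ⊗≋*ₛ : ∀ f g → (f ⊗ g) ℤzt.≈ (f ℤzt.* g)
  ⊗≋*ₛ f g n i = ≡.trans (⊗-coeff f g n i) (≡.sym (Σ<-coeff (suc n) _ i))

  one≋1ₛ : one ℤzt.≈ ℤzt.1#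
  one≋1ₛ zero    zero    = refl
  one≋1ₛ zero    (suc i) = refl
  one≋1ₛ (suc n) zero    = refl
  one≋1ₛ (suc n) (suc i) = refl

  ⊗-via : ∀ f g {h} → (f ℤzt.* g) ℤzt.≈ h → (f ⊗ g) ≈ h
  ⊗-via f g p = coeffs (ℤzt.trans (⊗≋*ₛ f g) p)

  ≈⇒≋ : ∀ {f g} → f ≈ g → f ℤzt.≈ g
  ≈⇒≋ f≈g = coeff f≈g

Ser-isCommutativeRing : IsCommutativeRing _≈_ _⊕_ _⊗_ neg zeroS one
Ser-isCommutativeRing = record
  { isRing = record
    { +-isAbelianGroup = record
      { isGroup = record
        { isMonoid = record
          { isSemigroup = record
            { isMagma = record
              { isEquivalence = record
                { refl  = coeffs (λ _ _ → refl)
                ; sym   = λ f≈g → coeffs (λ n i → ≡.sym (coeff f≈g n i))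
                ; trans = λ f≈g g≈h → coeffs (λ n i → ≡.trans (coeff f≈g n i) (coeff g≈h n i))
                }
              ; ∙-cong = λ f≈f′ g≈g′ → coeffs (λ n i → ≡.cong₂ ℤ._+_ (coeff f≈f′ n i) (coeff g≈g′ n i))
              }
            ; assoc = λ f g h → coeffs (λ n i → ℤP.+-assoc (f n i) _ _)
            }
          ; identity = (λ f → coeffs (λ n i → ℤP.+-identityˡ (f n i)))
                     , (λ f → coeffs (λ n i → ℤP.+-identityʳ (f n i)))
          }
        ; inverse = (λ f → coeffs (λ n i → ℤP.+-inverseˡ (f n i)))
                  , (λ f → coeffs (λ n i → ℤP.+-inverseʳ (f n i)))
        ; ⁻¹-cong = λ f≈g → coeffs (λ n i → ≡.cong ℤ.-_ (coeff f≈g n i))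
        }
      ; comm = λ f g → coeffs (λ n i → ℤP.+-comm (f n i) _)
      }
    ; *-cong = λ {f} {f′} {g} {g′} f≈f′ g≈g′ →
        ⊗-via f g (ℤzt.trans (ℤzt.*-cong (≈⇒≋ f≈f′) (≈⇒≋ g≈g′)) (ℤzt.sym (⊗≋*ₛ f′ g′)))
    ; *-assoc = λ f g h → ⊗-via (f ⊗ g) h (ℤzt.trans (ℤzt.*-cong (⊗≋*ₛ f g) (ℤzt.refl {h}))
        (ℤzt.trans (ℤzt.*-assoc f g h) (ℤzt.trans (ℤzt.*-cong (ℤzt.refl {f}) (ℤzt.sym (⊗≋*ₛ g h))) (ℤzt.sym (⊗≋*ₛ f (g ⊗ h))))))
    ; *-identity = (λ f → ⊗-via one f (ℤzt.trans (ℤzt.*-cong one≋1ₛ (ℤzt.refl {f})) (ℤzt.*-identityˡ f)))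
                 , (λ f → ⊗-via f one (ℤzt.trans (ℤzt.*-cong (ℤzt.refl {f}) one≋1ₛ) (ℤzt.*-identityʳ f)))
    ; distrib = (λ f g h → ⊗-via f (g ⊕ h) (ℤzt.trans (ℤzt.distribˡ f g h) (ℤzt.sym (ℤzt.+-cong (⊗≋*ₛ f g) (⊗≋*ₛ f h)))))
              , (λ f g h → ⊗-via (g ⊕ h) f (ℤzt.trans (ℤzt.distribʳ f g h) (ℤzt.sym (ℤzt.+-cong (⊗≋*ₛ g f) (⊗≋*ₛ h f)))))
    }
  ; *-comm = λ f g → ⊗-via f g (ℤzt.trans (ℤzt.*-comm f g) (ℤzt.sym (⊗≋*ₛ g f)))
  }

Ser-commutativeRing : CommutativeRing _ _
Ser-commutativeRing = record { isCommutativeRing = Ser-isCommutativeRing }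

open CommutativeRing Ser-commutativeRing public
  using (setoid)
  renaming ( refl to ≈-refl; sym to ≈-sym; trans to ≈-trans; reflexive to ≈-reflexive
           ; +-cong to ⊕-cong; +-comm to ⊕-comm
           ; +-identityˡ to ⊕-identityˡ; +-identityʳ to ⊕-identityʳ; -‿inverseʳ to neg-inverseʳ; -‿cong to neg-cong
           ; *-cong to ⊗-cong
           ; *-comm to ⊗-comm; *-assoc to ⊗-assoc; *-identityˡ to ⊗-identityˡ; *-identityʳ to ⊗-identityʳ
           ; distribˡ to ⊗-distribˡ; zeroʳ to ⊗-zeroʳ)

⊕-congˡ : ∀ f {g h} → g ≈ h → f ⊕ g ≈ f ⊕ h
⊕-congˡ f = ⊕-cong (≈-refl {f})

⊕-congʳ : ∀ h {f g} → f ≈ g → f ⊕ h ≈ g ⊕ h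
⊕-congʳ h f≈g = ⊕-cong f≈g (≈-refl {h})

⊗-congˡ : ∀ f {g h} → g ≈ h → f ⊗ g ≈ f ⊗ h
⊗-congˡ f = ⊗-cong (≈-refl {f})

⊗-congʳ : ∀ h {f g} → f ≈ g → f ⊗ h ≈ g ⊗ h
⊗-congʳ h f≈g = ⊗-cong f≈g (≈-refl {h})

module ≈-Reasoning = Relation.Binary.Reasoning.Setoid setoid

const : ℤ → Ser
const c = c · one

·-cong : ∀ {c d f g} → c ≡ d → f ≈ g → c · f ≈ d · g
·-cong {c} refl f≈g = coeffs (λ n i → ≡.cong (c ℤ.*_) (coeff f≈g n i))

·-congʳ : ∀ c {f g} → f ≈ g → c · f ≈ c · g
·-congʳ c = ·-cong {c} refl

·-assoc : ∀ c d f → c · (d · f) ≈ (c ℤ.* d) · f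
·-assoc c d f = coeffs (λ n i → ≡.sym (ℤP.*-assoc c d (f n i)))

·-identity : ∀ f → (+ 1) · f ≈ f
·-identity f = coeffs (λ n i → ℤP.*-identityˡ (f n i))

·-zero : ∀ f → (+ 0) · f ≈ zeroS
·-zero f = coeffs (λ n i → ℤP.*-zeroˡ (f n i))

·-⊗ : ∀ c f g → (c · f) ⊗ g ≈ c · (f ⊗ g)
·-⊗ c f g = coeffs λ n i → begin
  ((c · f) ⊗ g) n i
    ≡⟨ ⊗-coeff (c · f) g n i ⟩
  Σ< (suc n) (λ a → Σ< (suc i) (λ b → c ℤ.* f a b ℤ.* g (n ∸ a) (i ∸ b)))
    ≡⟨ Σ<-cong (suc n) (λ a → ≡.trans (Σ<-cong (suc i) (λ b → ℤP.*-assoc c _ _)) (≡.sym (*-distribˡ-Σ< (suc i) c _))) ⟩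
  Σ< (suc n) (λ a → c ℤ.* Σ< (suc i) (λ b → f a b ℤ.* g (n ∸ a) (i ∸ b)))
    ≡⟨ *-distribˡ-Σ< (suc n) c _ ⟨
  c ℤ.* Σ< (suc n) (λ a → Σ< (suc i) (λ b → f a b ℤ.* g (n ∸ a) (i ∸ b)))
    ≡⟨ ≡.cong (c ℤ.*_) (⊗-coeff f g n i) ⟨
  (c · (f ⊗ g)) n i ∎
  where open ≡.≡-Reasoning

⊗-· : ∀ c f g → f ⊗ (c · g) ≈ c · (f ⊗ g)
⊗-· c f g = ≈-trans (⊗-comm f (c · g)) (≈-trans (·-⊗ c g f) (·-congʳ c (⊗-comm g f)))

·≈const⊗ : ∀ c f → c · f ≈ const c ⊗ f
·≈const⊗ c f = ≈-sym (≈-trans (·-⊗ c one f) (·-congʳ c (⊗-identityˡ f)))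

Ser-almostCommutativeRing : ACR.AlmostCommutativeRing _ _
Ser-almostCommutativeRing = ACR.fromCommutativeRing Ser-commutativeRing

const-homomorphism : CommutativeRing.rawRing ℤP.+-*-commutativeRing ACR.-Raw-AlmostCommutative⟶ Ser-almostCommutativeRing
const-homomorphism = record
  { ⟦_⟧    = const
  ; +-homo = λ a b → coeffs (λ n i → ℤP.*-distribʳ-+ (one n i) a b)
  ; *-homo = λ a b → ≈-sym (≈-trans (·-⊗ a one (const b)) (≈-trans (·-congʳ a (⊗-identityˡ (const b))) (·-assoc a b one)))
  ; -‿homo = λ a → coeffs (λ n i → ≡.sym (ℤP.neg-distribˡ-* a (one n i)))
  ; 0-homo = ·-zero one
  ; 1-homo = ·-identity one
  }

open IntegerRingSolver Ser-almostCommutativeRing const-homomorphism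

mono-diag : ∀ m k → mono m k m k ≡ + 1
mono-diag m k with m ℕ.≟ m | k ℕ.≟ k
... | yes _    | yes _    = refl
... | no m≢m   | _        = ⊥-elim (m≢m refl)
... | yes _    | no k≢k   = ⊥-elim (k≢k refl)

mono-off-t : ∀ m k n i → m ≢ n → mono m k n i ≡ + 0
mono-off-t m k n i m≢n with m ℕ.≟ n | k ℕ.≟ i
... | yes m≡n | _ = ⊥-elim (m≢n m≡n)
... | no _    | _ = refl

mono-off-z : ∀ m k n i → k ≢ i → mono m k n i ≡ + 0
mono-off-z m k n i k≢i with m ℕ.≟ n | k ℕ.≟ i
... | yes _ | yes k≡i = ⊥-elim (k≢i k≡i)
... | yes _ | no _    = refl
... | no _  | _       = refl

≡0⇒*≡0ˡ : ∀ {a} b → a ≡ + 0 → a ℤ.* b ≡ + 0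
≡0⇒*≡0ˡ b refl = refl

≡0⇒*≡0ʳ : ∀ a {b} → b ≡ + 0 → a ℤ.* b ≡ + 0
≡0⇒*≡0ʳ a refl = ℤP.*-zeroʳ a

mono-⊗-shift : ∀ m k f n i → m ≤ n → k ≤ i → (mono m k ⊗ f) n i ≡ f (n ∸ m) (i ∸ k)
mono-⊗-shift m k f n i m≤n k≤i = begin
  (mono m k ⊗ f) n i
    ≡⟨ ⊗-coeff (mono m k) f n i ⟩
  Σ< (suc n) (λ a → Σ< (suc i) (λ b → mono m k a b ℤ.* f (n ∸ a) (i ∸ b)))
    ≡⟨ Σ<-single (suc n) m _ (s≤s m≤n) (λ a _ a≢m → Σ<-zero (suc i) _ (λ b _ →
         ≡0⇒*≡0ˡ (f (n ∸ a) (i ∸ b)) (mono-off-t m k a b (a≢m ∘ ≡.sym)))) ⟩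
  Σ< (suc i) (λ b → mono m k m b ℤ.* f (n ∸ m) (i ∸ b))
    ≡⟨ Σ<-single (suc i) k _ (s≤s k≤i) (λ b _ b≢k → ≡0⇒*≡0ˡ (f (n ∸ m) (i ∸ b)) (mono-off-z m k m b (b≢k ∘ ≡.sym))) ⟩
  mono m k m k ℤ.* f (n ∸ m) (i ∸ k)
    ≡⟨ ≡.cong (ℤ._* f (n ∸ m) (i ∸ k)) (mono-diag m k) ⟩
  + 1 ℤ.* f (n ∸ m) (i ∸ k)
    ≡⟨ ℤP.*-identityˡ _ ⟩
  f (n ∸ m) (i ∸ k) ∎
  where open ≡.≡-Reasoning

mono-⊗-below : ∀ m k f n i → n < m ⊎ i < k → (mono m k ⊗ f) n i ≡ + 0
mono-⊗-below m k f n i below = ≡.trans (⊗-coeff (mono m k) f n i)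
  (Σ<-zero (suc n) _ (λ a a≤n → Σ<-zero (suc i) _ (λ b b≤i → ≡0⇒*≡0ˡ (f (n ∸ a) (i ∸ b)) (vanish below a b (ℕP.≤-pred a≤n) (ℕP.≤-pred b≤i)))))
  where
  vanish : n < m ⊎ i < k → ∀ a b → a ≤ n → b ≤ i → mono m k a b ≡ + 0
  vanish (inj₁ n<m) a b a≤n b≤i = mono-off-t m k a b (λ { refl → ℕP.<-irrefl refl (ℕP.≤-<-trans a≤n n<m) })
  vanish (inj₂ i<k) a b a≤n b≤i = mono-off-z m k a b (λ { refl → ℕP.<-irrefl refl (ℕP.≤-<-trans b≤i i<k) })

mono-suc-t : ∀ a b n i → mono (suc a) b (suc n) i ≡ mono a b n i
mono-suc-t a b n i = by-cases (a ℕ.≟ n) (b ℕ.≟ i)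
  where
  by-cases : Dec (a ≡ n) → Dec (b ≡ i) → mono (suc a) b (suc n) i ≡ mono a b n i
  by-cases (yes refl) (yes refl) = ≡.trans (mono-diag (suc a) b) (≡.sym (mono-diag a b))
  by-cases (yes refl) (no b≢i)   = ≡.trans (mono-off-z (suc a) b (suc a) i b≢i) (≡.sym (mono-off-z a b a i b≢i))
  by-cases (no a≢n)   _          = ≡.trans (mono-off-t (suc a) b (suc n) i (a≢n ∘ ℕP.suc-injective)) (≡.sym (mono-off-t a b n i a≢n))

mono-suc-z : ∀ a b n i → mono a (suc b) n (suc i) ≡ mono a b n i
mono-suc-z a b n i = by-cases (a ℕ.≟ n) (b ℕ.≟ i)
  where
  by-cases : Dec (a ≡ n) → Dec (b ≡ i) → mono a (suc b) n (suc i) ≡ mono a b n i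
  by-cases (yes refl) (yes refl) = ≡.trans (mono-diag a (suc b)) (≡.sym (mono-diag a b))
  by-cases _          (no b≢i)   = ≡.trans (mono-off-z a (suc b) n (suc i) (b≢i ∘ ℕP.suc-injective)) (≡.sym (mono-off-z a b n i b≢i))
  by-cases (no a≢n)   (yes _)    = ≡.trans (mono-off-t a (suc b) n (suc i) a≢n) (≡.sym (mono-off-t a b n i a≢n))

tvar-⊗-mono : ∀ a b → tvar ⊗ mono a b ≈ mono (suc a) b
tvar-⊗-mono a b = coeffs λ where
  zero    i → ≡.trans (mono-⊗-below 1 0 (mono a b) 0 i (inj₁ (s≤s z≤n))) (≡.sym (mono-off-t (suc a) b 0 i (λ ())))
  (suc n) i → ≡.trans (mono-⊗-shift 1 0 (mono a b) (suc n) i (s≤s z≤n) z≤n) (≡.sym (mono-suc-t a b n i))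

zvar-⊗-mono : ∀ a b → zvar ⊗ mono a b ≈ mono a (suc b)
zvar-⊗-mono a b = coeffs λ where
  n zero    → ≡.trans (mono-⊗-below 0 1 (mono a b) n 0 (inj₂ (s≤s z≤n))) (≡.sym (mono-off-z a (suc b) n 0 (λ ())))
  n (suc i) → ≡.trans (mono-⊗-shift 0 1 (mono a b) n (suc i) z≤n (s≤s z≤n)) (≡.sym (mono-suc-z a b n i))

mono≈t^⊗z^ : ∀ a b → mono a b ≈ (tvar ^^ a) ⊗ (zvar ^^ b)
mono≈t^⊗z^ zero    zero    = ≈-sym (⊗-identityˡ one)
mono≈t^⊗z^ zero    (suc b) = ≈-trans (≈-sym (zvar-⊗-mono 0 b))
  (≈-trans (⊗-congˡ zvar (≈-trans (mono≈t^⊗z^ 0 b) (⊗-identityˡ (zvar ^^ b)))) (≈-sym (⊗-identityˡ (zvar ^^ suc b))))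
mono≈t^⊗z^ (suc a) b       = ≈-trans (≈-sym (tvar-⊗-mono a b)) (≈-trans (⊗-congˡ tvar (mono≈t^⊗z^ a b))
  (≈-sym (⊗-assoc tvar (tvar ^^ a) (zvar ^^ b))))

mono≈t^ : ∀ a → mono a 0 ≈ tvar ^^ a
mono≈t^ a = ≈-trans (mono≈t^⊗z^ a 0) (⊗-identityʳ (tvar ^^ a))

-- t-adic order and infinite sums

open FiniteSums Ser-commutativeRing using ()
  renaming ( Σ< to Σₛ; Σ<-cong to Σₛ-cong; Σ<-cong< to Σₛ-cong<; Σ<-+ to Σₛ-⊕; *-distribˡ-Σ< to ⊗-distribˡ-Σₛ
           ; -‿distrib-Σ< to neg-distrib-Σₛ; Σ<-zero to Σₛ-zero; Σ<-truncate to Σₛ-truncate; Σ<-head to Σₛ-head)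

Ord≥ : ℕ → Ser → Set
Ord≥ v f = ∀ n i → n < v → f n i ≡ + 0

Ord≥-zero : ∀ f → Ord≥ 0 f
Ord≥-zero f n i ()

Ord≥-weaken : ∀ {v w} f → w ≤ v → Ord≥ v f → Ord≥ w f
Ord≥-weaken f w≤v ord n i n<w = ord n i (ℕP.<-≤-trans n<w w≤v)

Ord≥-resp : ∀ {v f g} → f ≈ g → Ord≥ v f → Ord≥ v g
Ord≥-resp f≈g ord n i n<v = ≡.trans (≡.sym (coeff f≈g n i)) (ord n i n<v)

Ord≥-neg : ∀ {v} f → Ord≥ v f → Ord≥ v (neg f)
Ord≥-neg f ord n i n<v = ≡.cong ℤ.-_ (ord n i n<v)

Ord≥-· : ∀ {v} c f → Ord≥ v f → Ord≥ v (c · f)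
Ord≥-· c f ord n i n<v = ≡0⇒*≡0ʳ c (ord n i n<v)

Ord≥-⊗ : ∀ {a b} f g → Ord≥ a f → Ord≥ b g → Ord≥ (a ℕ.+ b) (f ⊗ g)
Ord≥-⊗ {a} {b} f g ord-f ord-g n i n<a+b = ≡.trans (⊗-coeff f g n i)
  (Σ<-zero (suc n) _ (λ c c≤n → Σ<-zero (suc i) _ (λ d _ → vanish c d (ℕP.≤-pred c≤n))))
  where
  vanish : ∀ c d → c ≤ n → f c d ℤ.* g (n ∸ c) (i ∸ d) ≡ + 0
  vanish c d c≤n with c ℕ.<? a
  ... | yes c<a = ≡0⇒*≡0ˡ (g (n ∸ c) (i ∸ d)) (ord-f c d c<a)
  ... | no  c≮a = ≡0⇒*≡0ʳ (f c d) (ord-g (n ∸ c) (i ∸ d) (ℕP.+-cancelˡ-< c _ _ (begin-strict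
      c ℕ.+ (n ∸ c) ≡⟨ ℕP.m+[n∸m]≡n c≤n ⟩
      n             <⟨ n<a+b ⟩
      a ℕ.+ b       ≤⟨ ℕP.+-monoˡ-≤ b (ℕP.≮⇒≥ c≮a) ⟩
      c ℕ.+ b       ∎)))
    where open ℕP.≤-Reasoning

Ord≥-⊗ˡ : ∀ {m} f g → Ord≥ m f → Ord≥ m (f ⊗ g)
Ord≥-⊗ˡ {m} f g ord = Ord≥-weaken (f ⊗ g) (ℕP.m≤m+n m 0) (Ord≥-⊗ f g ord (Ord≥-zero g))

Ord≥-⊗ʳ : ∀ {m} f g → Ord≥ m g → Ord≥ m (f ⊗ g)
Ord≥-⊗ʳ f g ord = Ord≥-⊗ f g (Ord≥-zero f) ord

Ord≥-tvar : Ord≥ 1 tvar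
Ord≥-tvar zero i _ = mono-off-t 1 0 0 i (λ ())
Ord≥-tvar (suc n) i (s≤s ())

Ord≥-tvar-⊗ : ∀ {v} f → Ord≥ v f → Ord≥ (suc v) (tvar ⊗ f)
Ord≥-tvar-⊗ f = Ord≥-⊗ tvar f Ord≥-tvar

Ord≥1-tvar⊗ : ∀ f → Ord≥ 1 (tvar ⊗ f)
Ord≥1-tvar⊗ f = Ord≥-tvar-⊗ f (Ord≥-zero f)

Ord≥1-tvar²⊗ : ∀ f → Ord≥ 1 ((tvar ⊗ tvar) ⊗ f)
Ord≥1-tvar²⊗ f = Ord≥-⊗ˡ (tvar ⊗ tvar) f (Ord≥1-tvar⊗ tvar)

Ord≥-^^ : ∀ f → Ord≥ 1 f → ∀ k → Ord≥ k (f ^^ k)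
Ord≥-^^ f ord zero    = Ord≥-zero (f ^^ 0)
Ord≥-^^ f ord (suc k) = Ord≥-⊗ f (f ^^ k) ord (Ord≥-^^ f ord k)

Ord≥-t^⊗ : ∀ k f → Ord≥ k ((tvar ^^ k) ⊗ f)
Ord≥-t^⊗ k f = Ord≥-⊗ˡ (tvar ^^ k) f (Ord≥-^^ tvar Ord≥-tvar k)

^^-cong : ∀ {f g} k → f ≈ g → f ^^ k ≈ g ^^ k
^^-cong zero    f≈g = ≈-refl
^^-cong (suc k) f≈g = ⊗-cong f≈g (^^-cong k f≈g)

^^-+ : ∀ f a b → f ^^ (a ℕ.+ b) ≈ (f ^^ a) ⊗ (f ^^ b)
^^-+ f zero    b = ≈-sym (⊗-identityˡ (f ^^ b))
^^-+ f (suc a) b = ≈-trans (⊗-congˡ f (^^-+ f a b)) (≈-sym (⊗-assoc f (f ^^ a) (f ^^ b)))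

^^-⊗ : ∀ f g k → (f ⊗ g) ^^ k ≈ (f ^^ k) ⊗ (g ^^ k)
^^-⊗ f g zero    = ≈-sym (⊗-identityˡ one)
^^-⊗ f g (suc k) = ≈-trans (⊗-congˡ (f ⊗ g) (^^-⊗ f g k))
  (solve 4 (λ a b c d → (a :* b) :* (c :* d) := (a :* c) :* (b :* d)) ≈-refl f g (f ^^ k) (g ^^ k))

^^-* : ∀ f a b → f ^^ (a ℕ.* b) ≈ (f ^^ a) ^^ b
^^-* f a zero    rewrite ℕP.*-zeroʳ a = ≈-refl
^^-* f a (suc b) rewrite ℕP.*-suc a b = ≈-trans (^^-+ f a (a ℕ.* b)) (⊗-congˡ (f ^^ a) (^^-* f a b))

^^-odd : ∀ f k → f ^^ suc (2 ℕ.* k) ≈ f ⊗ ((f ⊗ f) ^^ k)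
^^-odd f k = ⊗-congˡ f (≈-trans (^^-* f 2 k) (^^-cong k (⊗-congˡ f (⊗-identityʳ f))))

one^^ : ∀ i → one ^^ i ≈ one
one^^ zero    = ≈-refl
one^^ (suc i) = ≈-trans (⊗-identityˡ (one ^^ i)) (one^^ i)

Σₛ-coeff : ∀ N F n i → Σₛ N F n i ≡ Σ< N (λ k → F k n i)
Σₛ-coeff zero    F n i = refl
Σₛ-coeff (suc N) F n i = ≡.cong (ℤ._+ F N n i) (Σₛ-coeff N F n i)

Summable : (ℕ → Ser) → Set
Summable F = ∀ k → Ord≥ k (F k)

-- Only F 0, …, F n enter the coefficient of tⁿ; this is the sum of F when F is summable.
Σ∞ : (ℕ → Ser) → Ser
Σ∞ F n i = Σ< (suc n) (λ k → F k n i)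

Σ∞-cong : ∀ {F G} → (∀ k → F k ≈ G k) → Σ∞ F ≈ Σ∞ G
Σ∞-cong F≈G = coeffs (λ n i → Σ<-cong (suc n) (λ k → coeff (F≈G k) n i))

Σ∞-⊕ : ∀ F G → Σ∞ (λ k → F k ⊕ G k) ≈ Σ∞ F ⊕ Σ∞ G
Σ∞-⊕ F G = coeffs (λ n i → Σ<-+ (suc n) _ _)

Σ∞-neg : ∀ F → Σ∞ (λ k → neg (F k)) ≈ neg (Σ∞ F)
Σ∞-neg F = coeffs (λ n i → ≡.sym (-‿distrib-Σ< (suc n) _))

Σ∞-· : ∀ c F → Σ∞ (λ k → c · F k) ≈ c · Σ∞ F
Σ∞-· c F = coeffs (λ n i → ≡.sym (*-distribˡ-Σ< (suc n) c _))

Σ∞-partial : ∀ F → Summable F → ∀ {m N} i → m < N → Σ< N (λ k → F k m i) ≡ Σ∞ F m i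
Σ∞-partial F summable i m<N = Σ<-truncate _ _ _ m<N (λ k m<k _ → summable k _ i m<k)

⊗-local : ∀ g {h h′} n i → (∀ m j → m ≤ n → h m j ≡ h′ m j) → (g ⊗ h) n i ≡ (g ⊗ h′) n i
⊗-local g {h} {h′} n i h≡h′ = ≡.trans (⊗-coeff g h n i) (≡.trans
  (Σ<-cong (suc n) (λ a → Σ<-cong (suc i) (λ b → ≡.cong (g a b ℤ.*_) (h≡h′ (n ∸ a) (i ∸ b) (ℕP.m∸n≤m n a)))))
  (≡.sym (⊗-coeff g h′ n i)))

⊗-distribˡ-Σ∞ : ∀ F → Summable F → ∀ g → g ⊗ Σ∞ F ≈ Σ∞ (λ k → g ⊗ F k)
⊗-distribˡ-Σ∞ F summable g = coeffs λ n i → begin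
  (g ⊗ Σ∞ F) n i                        ≡⟨ ⊗-local g n i (λ m j m≤n → ≡.trans (≡.sym (Σ∞-partial F summable j (s≤s m≤n)))
                                                                        (≡.sym (Σₛ-coeff (suc n) F m j))) ⟩
  (g ⊗ Σₛ (suc n) F) n i                ≡⟨ coeff (⊗-distribˡ-Σₛ (suc n) g F) n i ⟩
  Σₛ (suc n) (λ k → g ⊗ F k) n i        ≡⟨ Σₛ-coeff (suc n) _ n i ⟩
  Σ∞ (λ k → g ⊗ F k) n i                ∎
  where open ≡.≡-Reasoning

⊗-distribʳ-Σ∞ : ∀ F → Summable F → ∀ g → Σ∞ F ⊗ g ≈ Σ∞ (λ k → F k ⊗ g)
⊗-distribʳ-Σ∞ F summable g = ≈-trans (⊗-comm (Σ∞ F) g)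
  (≈-trans (⊗-distribˡ-Σ∞ F summable g) (Σ∞-cong (λ k → ⊗-comm g (F k))))

Σ∞-head : ∀ F → Summable F → Σ∞ F ≈ F 0 ⊕ Σ∞ (λ k → F (suc k))
Σ∞-head F summable = coeffs λ n i → ≡.trans (Σ<-head n _) (≡.cong (λ s → F 0 n i ℤ.+ s) (≡.sym
  (≡.trans (≡.cong (λ s → Σ< n (λ k → F (suc k) n i) ℤ.+ s) (summable (suc n) n i (ℕP.n<1+n n))) (ℤP.+-identityʳ _))))

Σ∞-single : ∀ F m → (∀ k → k ≢ m → F k ≈ zeroS) → Ord≥ m (F m) → Σ∞ F ≈ F m
Σ∞-single F m others ord = coeffs λ n i → by-cases n i (m ℕ.≤? n)
  where
  by-cases : ∀ n i → Dec (m ≤ n) → Σ∞ F n i ≡ F m n i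
  by-cases n i (yes m≤n) = Σ<-single (suc n) m _ (s≤s m≤n) (λ k _ k≢m → coeff (others k k≢m) n i)
  by-cases n i (no m≰n)  = ≡.trans (Σ<-zero (suc n) _ (λ k k≤n → coeff (others k (λ { refl → m≰n (ℕP.≤-pred k≤n) })) n i))
                                   (≡.sym (ord n i (ℕP.≰⇒> m≰n)))

Σ∞-diagonal : ∀ (H : ℕ → ℕ → Ser) → (∀ a b → Ord≥ (a ℕ.+ b) (H a b)) →
              Σ∞ (λ a → Σ∞ (H a)) ≈ Σ∞ (λ m → Σₛ (suc m) (λ a → H a (m ∸ a)))
Σ∞-diagonal H ord = coeffs λ n i → ≡.sym (begin
  Σ< (suc n) (λ m → Σₛ (suc m) (λ a → H a (m ∸ a)) n i)
    ≡⟨ Σ<-cong (suc n) (λ m → Σₛ-coeff (suc m) _ n i) ⟩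
  Σ< (suc n) (λ m → Σ< (suc m) (λ a → H a (m ∸ a) n i))
    ≡⟨ Σ<-triangle n (λ a m → H a (m ∸ a) n i) ⟩
  Σ< (suc n) (λ a → Σ< (suc (n ∸ a)) (λ b → H a (a ℕ.+ b ∸ a) n i))
    ≡⟨ Σ<-cong< (suc n) (λ a a≤n → ≡.trans (Σ<-cong (suc (n ∸ a)) (λ b → ≡.cong (λ c → H a c n i) (ℕP.m+n∸m≡n a b)))
                                           (≡.sym (row n i a (ℕP.≤-pred a≤n)))) ⟩
  Σ< (suc n) (λ a → Σ∞ (H a) n i) ∎)
  where
  open ≡.≡-Reasoning
  row : ∀ n i a → a ≤ n → Σ< (suc n) (λ b → H a b n i) ≡ Σ< (suc (n ∸ a)) (λ b → H a b n i)
  row n i a a≤n = Σ<-truncate _ _ _ (s≤s (ℕP.m∸n≤m n a)) (λ b n∸a<b _ →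
    ord a b n i (≡.subst (_< a ℕ.+ b) (ℕP.m+[n∸m]≡n a≤n) (ℕP.+-monoʳ-< a n∸a<b)))

Σ∞-⊗ : ∀ F G → Summable F → Summable G →
       Σ∞ F ⊗ Σ∞ G ≈ Σ∞ (λ m → Σₛ (suc m) (λ a → F a ⊗ G (m ∸ a)))
Σ∞-⊗ F G summable-F summable-G = begin
  Σ∞ F ⊗ Σ∞ G                            ≈⟨ ⊗-distribʳ-Σ∞ F summable-F (Σ∞ G) ⟩
  Σ∞ (λ a → F a ⊗ Σ∞ G)                  ≈⟨ Σ∞-cong (λ a → ⊗-distribˡ-Σ∞ G summable-G (F a)) ⟩
  Σ∞ (λ a → Σ∞ (λ b → F a ⊗ G b))        ≈⟨ Σ∞-diagonal (λ a b → F a ⊗ G b) (λ a b → Ord≥-⊗ (F a) (G b) (summable-F a) (summable-G b)) ⟩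
  Σ∞ (λ m → Σₛ (suc m) (λ a → F a ⊗ G (m ∸ a))) ∎
  where open ≈-Reasoning

Σₛ-· : ∀ N (c : ℕ → ℤ) X → Σₛ N (λ j → c j · X) ≈ Σ< N c · X
Σₛ-· N c X = coeffs λ n i → ≡.trans (Σₛ-coeff N _ n i) (≡.sym (*-distribʳ-Σ< N (X n i) c))

Σ∞-monomials : ∀ (c : Ser) → (∀ k i → k < i → c k i ≡ + 0) → Σ∞ (λ k → Σₛ (suc k) (λ i → c k i · mono k i)) ≈ c
Σ∞-monomials c upper = coeffs λ n i′ → begin
  Σ< (suc n) (λ k → Σₛ (suc k) (λ i → c k i · mono k i) n i′)
    ≡⟨ Σ<-cong (suc n) (λ k → Σₛ-coeff (suc k) _ n i′) ⟩
  Σ< (suc n) (λ k → Σ< (suc k) (λ i → c k i ℤ.* mono k i n i′))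
    ≡⟨ Σ<-single (suc n) n _ (ℕP.n<1+n n) (λ k _ k≢n → Σ<-zero (suc k) _ (λ i _ → ≡0⇒*≡0ʳ (c k i) (mono-off-t k i n i′ k≢n))) ⟩
  Σ< (suc n) (λ i → c n i ℤ.* mono n i n i′)
    ≡⟨ diagonal (i′ ℕ.≤? n) ⟩
  c n i′ ∎
  where
  open ≡.≡-Reasoning
  diagonal : ∀ {n i′} → Dec (i′ ≤ n) → Σ< (suc n) (λ i → c n i ℤ.* mono n i n i′) ≡ c n i′
  diagonal {n} {i′} (yes i′≤n) = ≡.trans (Σ<-single (suc n) i′ _ (s≤s i′≤n) (λ i _ i≢i′ → ≡0⇒*≡0ʳ (c n i) (mono-off-z n i n i′ i≢i′)))
                                         (≡.trans (≡.cong (c n i′ ℤ.*_) (mono-diag n i′)) (ℤP.*-identityʳ (c n i′)))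
  diagonal {n} {i′} (no i′≰n)  = ≡.trans (Σ<-zero (suc n) _ (λ i i≤n → ≡0⇒*≡0ʳ (c n i) (mono-off-z n i n i′ (λ { refl → i′≰n (ℕP.≤-pred i≤n) }))))
                                         (≡.sym (upper n i′ (ℕP.≰⇒> i′≰n)))

t^⊗Σz^ : ∀ k N (c : ℕ → ℤ) → (tvar ^^ k) ⊗ Σₛ N (λ i → c i · (zvar ^^ i)) ≈ Σₛ N (λ i → c i · mono k i)
t^⊗Σz^ k N c = ≈-trans (⊗-distribˡ-Σₛ N (tvar ^^ k) (λ i → c i · (zvar ^^ i)))
  (Σₛ-cong N (λ i → ≈-trans (⊗-· (c i) (tvar ^^ k) (zvar ^^ i)) (·-congʳ (c i) (≈-sym (mono≈t^⊗z^ k i)))))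

-- Substitution into univariate series

module ℤ[[s]] = PowerSeries ℤP.+-*-commutativeRing
open ℤ[[s]] using (Series; _≋_; _+ₛ_; _*ₛ_; -ₛ_; 1ₛ)

svar : Series
svar (suc zero) = + 1
svar _          = + 0

_^ₛ_ : Series → ℕ → Series
a ^ₛ zero  = 1ₛ
a ^ₛ suc k = a *ₛ (a ^ₛ k)

svar-*ₛ : ∀ h m → (svar *ₛ h) (suc m) ≡ h m
svar-*ₛ h m = ≡.trans (Σ<-single (suc (suc m)) 1 _ (s≤s (s≤s z≤n)) others) (ℤP.*-identityˡ (h m))
  where
  others : ∀ k → k < suc (suc m) → k ≢ 1 → svar k ℤ.* h (suc m ∸ k) ≡ + 0
  others zero          _ _   = refl
  others (suc zero)    _ k≢1 = ⊥-elim (k≢1 refl)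
  others (suc (suc k)) _ _   = refl

compose : Series → Ser → Ser
compose a σ = Σ∞ (λ k → a k · (σ ^^ k))

module _ (σ : Ser) (ord-σ : Ord≥ 1 σ) where

  compose-summable : ∀ (a : Series) → Summable (λ k → a k · (σ ^^ k))
  compose-summable a k = Ord≥-· (a k) (σ ^^ k) (Ord≥-^^ σ ord-σ k)

  compose-cong : ∀ {a b} → a ≋ b → compose a σ ≈ compose b σ
  compose-cong a≋b = Σ∞-cong (λ k → ·-cong (a≋b k) (≈-refl {σ ^^ k}))

  compose-+ : ∀ a b → compose (a +ₛ b) σ ≈ compose a σ ⊕ compose b σ
  compose-+ a b = ≈-trans (Σ∞-cong (λ k → coeffs (λ n i → ℤP.*-distribʳ-+ ((σ ^^ k) n i) (a k) (b k))))
                          (Σ∞-⊕ (λ k → a k · (σ ^^ k)) (λ k → b k · (σ ^^ k)))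

  compose-neg : ∀ a → compose (-ₛ a) σ ≈ neg (compose a σ)
  compose-neg a = ≈-trans (Σ∞-cong (λ k → coeffs (λ n i → ≡.sym (ℤP.neg-distribˡ-* (a k) ((σ ^^ k) n i)))))
                          (Σ∞-neg (λ k → a k · (σ ^^ k)))

  compose-* : ∀ a b → compose (a *ₛ b) σ ≈ compose a σ ⊗ compose b σ
  compose-* a b = ≈-sym (begin
    compose a σ ⊗ compose b σ
      ≈⟨ Σ∞-⊗ (λ k → a k · (σ ^^ k)) (λ k → b k · (σ ^^ k)) (compose-summable a) (compose-summable b) ⟩
    Σ∞ (λ m → Σₛ (suc m) (λ j → (a j · (σ ^^ j)) ⊗ (b (m ∸ j) · (σ ^^ (m ∸ j)))))
      ≈⟨ Σ∞-cong (λ m → Σₛ-cong< (suc m) (λ j j≤m → collect m j (ℕP.≤-pred j≤m))) ⟩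
    Σ∞ (λ m → Σₛ (suc m) (λ j → (a j ℤ.* b (m ∸ j)) · (σ ^^ m)))
      ≈⟨ Σ∞-cong (λ m → coeffs (λ n i → ≡.trans (Σₛ-coeff (suc m) _ n i) (≡.sym (*-distribʳ-Σ< (suc m) _ _)))) ⟩
    compose (a *ₛ b) σ ∎)
    where
    open ≈-Reasoning
    collect : ∀ m j → j ≤ m → (a j · (σ ^^ j)) ⊗ (b (m ∸ j) · (σ ^^ (m ∸ j))) ≈ (a j ℤ.* b (m ∸ j)) · (σ ^^ m)
    collect m j j≤m = begin
      (a j · (σ ^^ j)) ⊗ (b (m ∸ j) · (σ ^^ (m ∸ j)))   ≈⟨ ·-⊗ (a j) (σ ^^ j) (b (m ∸ j) · (σ ^^ (m ∸ j))) ⟩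
      a j · ((σ ^^ j) ⊗ (b (m ∸ j) · (σ ^^ (m ∸ j))))   ≈⟨ ·-congʳ (a j) (⊗-· (b (m ∸ j)) (σ ^^ j) (σ ^^ (m ∸ j))) ⟩
      a j · (b (m ∸ j) · ((σ ^^ j) ⊗ (σ ^^ (m ∸ j))))   ≈⟨ ·-assoc (a j) (b (m ∸ j)) ((σ ^^ j) ⊗ (σ ^^ (m ∸ j))) ⟩
      (a j ℤ.* b (m ∸ j)) · ((σ ^^ j) ⊗ (σ ^^ (m ∸ j))) ≈⟨ ·-congʳ (a j ℤ.* b (m ∸ j)) (≈-sym (^^-+ σ j (m ∸ j))) ⟩
      (a j ℤ.* b (m ∸ j)) · (σ ^^ (j ℕ.+ (m ∸ j)))      ≡⟨ ≡.cong (λ e → (a j ℤ.* b (m ∸ j)) · (σ ^^ e)) (ℕP.m+[n∸m]≡n j≤m) ⟩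
      (a j ℤ.* b (m ∸ j)) · (σ ^^ m)                    ∎

  compose-1ₛ : compose 1ₛ σ ≈ one
  compose-1ₛ = ≈-trans (Σ∞-single _ 0 others (Ord≥-zero _)) (·-identity one)
    where
    others : ∀ k → k ≢ 0 → 1ₛ k · (σ ^^ k) ≈ zeroS
    others zero    k≢0 = ⊥-elim (k≢0 refl)
    others (suc k) _   = ·-zero (σ ^^ suc k)

  compose-svar : compose svar σ ≈ σ
  compose-svar = ≈-trans (Σ∞-single _ 1 others (Ord≥-· (+ 1) (σ ^^ 1) (Ord≥-^^ σ ord-σ 1)))
                         (≈-trans (·-identity (σ ^^ 1)) (⊗-identityʳ σ))
    where
    others : ∀ k → k ≢ 1 → svar k · (σ ^^ k) ≈ zeroS
    others zero          _   = ·-zero one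
    others (suc zero)    k≢1 = ⊥-elim (k≢1 refl)
    others (suc (suc k)) _   = ·-zero (σ ^^ suc (suc k))

  compose-^ₛ : ∀ a k → compose (a ^ₛ k) σ ≈ compose a σ ^^ k
  compose-^ₛ a zero    = compose-1ₛ
  compose-^ₛ a (suc k) = ≈-trans (compose-* a (a ^ₛ k)) (⊗-congˡ (compose a σ) (compose-^ₛ a k))

-- Catalan numbers

module _ where
  open import Data.Nat using (_+_; _*_)
  open ℕP using (*-distribˡ-+; +-cancelˡ-≡; *-cancelˡ-≡; *-comm)
  open ≡.≡-Reasoning
  open ℕ-Solver using (solve-∀)

  [1+k]*[1+n]C[1+k]≡[1+n]*nCk : ∀ n k → suc k * (suc n C suc k) ≡ suc n * (n C k)
  [1+k]*[1+n]C[1+k]≡[1+n]*nCk zero    zero    = refl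
  [1+k]*[1+n]C[1+k]≡[1+n]*nCk zero    (suc k) = ℕP.*-zeroʳ (suc (suc k))
  [1+k]*[1+n]C[1+k]≡[1+n]*nCk (suc n) zero    = ≡.trans (ℕP.+-identityʳ _) (≡.trans (nC1≡n (suc (suc n))) (≡.sym (ℕP.*-identityʳ _)))
  [1+k]*[1+n]C[1+k]≡[1+n]*nCk (suc n) (suc k) = begin
    (2 + k) * (suc (suc n) C suc (suc k))   ≡⟨ ≡.cong ((2 + k) *_) (nCk+nC[k+1]≡[n+1]C[k+1] (suc n) (suc k)) ⟨
    (2 + k) * (x + y)                       ≡⟨ expand (suc k) x y ⟩
    x + (1 + k) * x + (2 + k) * y           ≡⟨ ≡.cong₂ (λ p q → x + p + q) ([1+k]*[1+n]C[1+k]≡[1+n]*nCk n k)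
                                                                          ([1+k]*[1+n]C[1+k]≡[1+n]*nCk n (suc k)) ⟩
    x + (1 + n) * u + (1 + n) * v           ≡⟨ collect x (suc n) u v ⟩
    x + (1 + n) * (u + v)                   ≡⟨ ≡.cong (λ w → x + (1 + n) * w) (nCk+nC[k+1]≡[n+1]C[k+1] n k) ⟩
    x + (1 + n) * x                         ≡⟨⟩
    (2 + n) * x                             ∎
    where
    x = suc n C suc k
    y = suc n C suc (suc k)
    u = n C k
    v = n C suc k
    expand : ∀ k x y → suc k * (x + y) ≡ x + k * x + suc k * y
    expand = solve-∀
    collect : ∀ x m u v → x + m * u + m * v ≡ x + m * (u + v)
    collect = solve-∀

  [1+k]*[2k]C[1+k]≡k*[2k]Ck : ∀ k → suc k * ((2 * k) C suc k) ≡ k * ((2 * k) C k)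
  [1+k]*[2k]C[1+k]≡k*[2k]Ck k = +-cancelˡ-≡ (suc k * x) _ _ (begin
    suc k * x + suc k * y          ≡⟨ *-distribˡ-+ (suc k) x y ⟨
    suc k * (x + y)                ≡⟨ ≡.cong (suc k *_) (nCk+nC[k+1]≡[n+1]C[k+1] (2 * k) k) ⟩
    suc k * (suc (2 * k) C suc k)  ≡⟨ [1+k]*[1+n]C[1+k]≡[1+n]*nCk (2 * k) k ⟩
    suc (2 * k) * x                ≡⟨ split k x ⟩
    suc k * x + k * x              ∎)
    where
    x = (2 * k) C k
    y = (2 * k) C suc k
    split : ∀ k x → suc (2 * k) * x ≡ suc k * x + k * x
    split = solve-∀

  -- k + 1 divides C(2k,k), so the truncating division in catalan is exact.
  [2k]Ck≡[[2k]Ck∸[2k]C[1+k]]*[1+k] : ∀ k → (2 * k) C k ≡ ((2 * k) C k ∸ (2 * k) C suc k) * suc k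
  [2k]Ck≡[[2k]Ck∸[2k]C[1+k]]*[1+k] k = ≡.sym (begin
    (x ∸ y) * suc k          ≡⟨ ℕP.*-distribʳ-∸ (suc k) x y ⟩
    x * suc k ∸ y * suc k    ≡⟨ ≡.cong₂ _∸_ (split x k) (≡.trans (*-comm y (suc k)) ([1+k]*[2k]C[1+k]≡k*[2k]Ck k)) ⟩
    x + k * x ∸ k * x        ≡⟨ ℕP.m+n∸n≡m x (k * x) ⟩
    x                        ∎)
    where
    x = (2 * k) C k
    y = (2 * k) C suc k
    split : ∀ x k → x * suc k ≡ x + k * x
    split = solve-∀

  [1+k]*catalan[k]≡[2k]Ck : ∀ k → suc k * catalan k ≡ (2 * k) C k
  [1+k]*catalan[k]≡[2k]Ck k = begin
    suc k * (((2 * k) C k) / suc k)      ≡⟨ ≡.cong (λ x → suc k * (x / suc k)) ([2k]Ck≡[[2k]Ck∸[2k]C[1+k]]*[1+k] k) ⟩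
    suc k * ((d * suc k) / suc k)        ≡⟨ ≡.cong (suc k *_) (m*n/n≡m d (suc k)) ⟩
    suc k * d                            ≡⟨ *-comm (suc k) d ⟩
    d * suc k                            ≡⟨ [2k]Ck≡[[2k]Ck∸[2k]C[1+k]]*[1+k] k ⟨
    (2 * k) C k                          ∎
    where d = (2 * k) C k ∸ (2 * k) C suc k

  [1+k]*[2+2k]C[1+k]≡[2+4k]*[2k]Ck : ∀ k → suc k * ((2 * suc k) C suc k) ≡ (2 + 4 * k) * ((2 * k) C k)
  [1+k]*[2+2k]C[1+k]≡[2+4k]*[2k]Ck k = begin
    suc k * ((2 * suc k) C suc k)                          ≡⟨ ≡.cong (λ n → suc k * (n C suc k)) (ℕP.+-suc (suc k) (k + 0)) ⟩
    suc k * (suc (suc (2 * k)) C suc k)                    ≡⟨ ≡.cong (suc k *_) (nCk+nC[k+1]≡[n+1]C[k+1] (suc (2 * k)) k) ⟨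
    suc k * (suc (2 * k) C k + suc (2 * k) C suc k)        ≡⟨ ≡.cong (λ z → suc k * (z + suc (2 * k) C suc k)) symmetry ⟩
    suc k * (suc (2 * k) C suc k + suc (2 * k) C suc k)    ≡⟨ double (suc k) (suc (2 * k) C suc k) ⟩
    2 * (suc k * (suc (2 * k) C suc k))                    ≡⟨ ≡.cong (2 *_) ([1+k]*[1+n]C[1+k]≡[1+n]*nCk (2 * k) k) ⟩
    2 * (suc (2 * k) * ((2 * k) C k))                      ≡⟨ regroup k ((2 * k) C k) ⟩
    (2 + 4 * k) * ((2 * k) C k)                            ∎
    where
    reorder : ∀ k → suc (2 * k) ≡ suc k + k
    reorder = solve-∀
    symmetry : suc (2 * k) C k ≡ suc (2 * k) C suc k
    symmetry = ≡.trans (nCk≡nC[n∸k] (ℕP.≤-trans (ℕP.m≤m+n k (k + 0)) (ℕP.n≤1+n _)))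
                       (≡.cong (suc (2 * k) C_) (≡.trans (≡.cong (_∸ k) (reorder k)) (ℕP.m+n∸n≡m (suc k) k)))
    double : ∀ a b → a * (b + b) ≡ 2 * (a * b)
    double = solve-∀
    regroup : ∀ k x → 2 * (suc (2 * k) * x) ≡ (2 + 4 * k) * x
    regroup = solve-∀

  catalan-recurrence : ∀ k → (2 + k) * catalan (suc k) ≡ (2 + 4 * k) * catalan k
  catalan-recurrence k = *-cancelˡ-≡ _ _ (suc k) (begin
    suc k * ((2 + k) * catalan (suc k))     ≡⟨ ≡.cong (suc k *_) ([1+k]*catalan[k]≡[2k]Ck (suc k)) ⟩
    suc k * ((2 * suc k) C suc k)           ≡⟨ [1+k]*[2+2k]C[1+k]≡[2+4k]*[2k]Ck k ⟩
    (2 + 4 * k) * ((2 * k) C k)             ≡⟨ ≡.cong ((2 + 4 * k) *_) ([1+k]*catalan[k]≡[2k]Ck k) ⟨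
    (2 + 4 * k) * (suc k * catalan k)       ≡⟨ swap (2 + 4 * k) (suc k) (catalan k) ⟩
    suc k * ((2 + 4 * k) * catalan k)       ∎)
    where
    swap : ∀ a b c → a * (b * c) ≡ b * (a * c)
    swap = solve-∀

catalanℤ : Series
catalanℤ k = + catalan k

module _ where
  open import Data.Integer using (_+_; _*_; _-_; -_)
  open ≡.≡-Reasoning
  open ℤ-Solver using (solve-∀)

  private
    c = catalanℤ

  catalanℤ-recurrence : ∀ k → (+ k + + 2) * c (suc k) ≡ (+ 2 + + 4 * + k) * c k
  catalanℤ-recurrence k = begin
    (+ k + + 2) * c (suc k)                 ≡⟨ ≡.cong (_* c (suc k)) (≡.trans (≡.sym (ℤP.pos-+ k 2)) (≡.cong ℤ.+_ (ℕP.+-comm k 2))) ⟩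
    + (2 ℕ.+ k) * c (suc k)                 ≡⟨ ℤP.pos-* (2 ℕ.+ k) (catalan (suc k)) ⟨
    + ((2 ℕ.+ k) ℕ.* catalan (suc k))       ≡⟨ ≡.cong ℤ.+_ (catalan-recurrence k) ⟩
    + ((2 ℕ.+ 4 ℕ.* k) ℕ.* catalan k)       ≡⟨ ℤP.pos-* (2 ℕ.+ 4 ℕ.* k) (catalan k) ⟩
    + (2 ℕ.+ 4 ℕ.* k) * c k                 ≡⟨ ≡.cong (_* c k) (≡.trans (ℤP.pos-+ 2 (4 ℕ.* k)) (≡.cong (λ z → + 2 + z) (ℤP.pos-* 4 k))) ⟩
    (+ 2 + + 4 * + k) * c k                 ∎

  -- Segner's recurrence S_m = c_{m+1} for S_m = Σ c_a c_{m−a} follows from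
  -- (k+2) c_{k+1} = (4k+2) c_k through the weighted sums W_m = Σ a c_a c_{m−a}:
  -- symmetry gives 2 W_m = m S_m and the recurrence W_{m+1} = 4 W_m + 2 S_m − Σ c_{a+1} c_{m−a}.
  catalan-convolution-sum : ℕ → ℤ
  catalan-convolution-sum m = Σ< (suc m) (λ a → c a * c (m ∸ a))

  private
    S = catalan-convolution-sum

    +[1+m]≡+m+1 : ∀ m → + suc m ≡ + m + + 1
    +[1+m]≡+m+1 m = ≡.trans (≡.cong ℤ.+_ (ℕP.+-comm 1 m)) (ℤP.pos-+ m 1)

    weighted : ℕ → ℤ
    weighted m = Σ< (suc m) (λ a → + a * (c a * c (m ∸ a)))

    shifted : ℕ → ℤ
    shifted m = Σ< (suc m) (λ a → c (suc a) * c (m ∸ a))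

    weighted-symmetric : ∀ m → weighted m + weighted m ≡ + m * S m
    weighted-symmetric m = begin
      weighted m + weighted m
        ≡⟨ ≡.cong (λ w → weighted m + w) (≡.trans (Σ<-reverse m _) (Σ<-cong< (suc m) mirror)) ⟩
      weighted m + Σ< (suc m) (λ a → + (m ∸ a) * (c a * c (m ∸ a)))
        ≡⟨ Σ<-+ (suc m) _ _ ⟨
      Σ< (suc m) (λ a → + a * (c a * c (m ∸ a)) + + (m ∸ a) * (c a * c (m ∸ a)))
        ≡⟨ Σ<-cong< (suc m) (λ a a≤m → ≡.trans (≡.sym (ℤP.*-distribʳ-+ (c a * c (m ∸ a)) (+ a) (+ (m ∸ a))))
                                         (≡.cong (_* (c a * c (m ∸ a))) (≡.trans (≡.sym (ℤP.pos-+ a (m ∸ a))) (≡.cong ℤ.+_ (ℕP.m+[n∸m]≡n (ℕP.≤-pred a≤m)))))) ⟩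
      Σ< (suc m) (λ a → + m * (c a * c (m ∸ a)))
        ≡⟨ *-distribˡ-Σ< (suc m) (+ m) _ ⟨
      + m * S m ∎
      where
      mirror : ∀ a → a < suc m → + (m ∸ a) * (c (m ∸ a) * c (m ∸ (m ∸ a))) ≡ + (m ∸ a) * (c a * c (m ∸ a))
      mirror a a≤m rewrite ℕP.m∸[m∸n]≡n (ℕP.≤-pred a≤m) = ≡.cong (+ (m ∸ a) *_) (ℤP.*-comm (c (m ∸ a)) (c a))

    weighted-term : ∀ (A p q r : ℤ) → (A + + 2) * p ≡ (+ 2 + + 4 * A) * q →
                    (A + + 1) * (p * r) ≡ + 4 * (A * (q * r)) + + 2 * (q * r) - p * r
    weighted-term A p q r rec = begin
      (A + + 1) * (p * r)                            ≡⟨ expand A p r ⟩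
      ((A + + 2) * p) * r - p * r                    ≡⟨ ≡.cong (λ z → z * r - p * r) rec ⟩
      ((+ 2 + + 4 * A) * q) * r - p * r              ≡⟨ collect A q r p ⟩
      + 4 * (A * (q * r)) + + 2 * (q * r) - p * r    ∎
      where
      expand : ∀ (A p r : ℤ) → (A + + 1) * (p * r) ≡ ((A + + 2) * p) * r - p * r
      expand = solve-∀
      collect : ∀ (A q r p : ℤ) → ((+ 2 + + 4 * A) * q) * r - p * r ≡ + 4 * (A * (q * r)) + + 2 * (q * r) - p * r
      collect = solve-∀

    weighted-suc : ∀ m → weighted (suc m) ≡ + 4 * weighted m + + 2 * S m - shifted m
    weighted-suc m = begin
      weighted (suc m)
        ≡⟨ ≡.trans (Σ<-head (suc m) _) (ℤP.+-identityˡ _) ⟩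
      Σ< (suc m) (λ a → + suc a * (c (suc a) * c (m ∸ a)))
        ≡⟨ Σ<-cong (suc m) (λ a → ≡.trans (≡.cong (_* (c (suc a) * c (m ∸ a))) (+[1+m]≡+m+1 a))
                                            (weighted-term (+ a) (c (suc a)) (c a) (c (m ∸ a)) (catalanℤ-recurrence a))) ⟩
      Σ< (suc m) (λ a → + 4 * (+ a * (c a * c (m ∸ a))) + + 2 * (c a * c (m ∸ a)) - c (suc a) * c (m ∸ a))
        ≡⟨ Σ<-+ (suc m) _ _ ⟩
      Σ< (suc m) (λ a → + 4 * (+ a * (c a * c (m ∸ a))) + + 2 * (c a * c (m ∸ a))) + Σ< (suc m) (λ a → - (c (suc a) * c (m ∸ a)))
        ≡⟨ ≡.cong₂ _+_ (≡.trans (Σ<-+ (suc m) _ _) (≡.sym (≡.cong₂ _+_ (*-distribˡ-Σ< (suc m) (+ 4) _) (*-distribˡ-Σ< (suc m) (+ 2) _))))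
                       (≡.sym (-‿distrib-Σ< (suc m) _)) ⟩
      + 4 * weighted m + + 2 * S m - shifted m ∎

    S-suc : ∀ m → S (suc m) ≡ + 1 * c (suc m) + shifted m
    S-suc m = Σ<-head (suc m) _

    S-step : ∀ m → (+ m + + 3) * S (suc m) ≡ + 4 * (+ m + + 1) * S m + + 2 * c (suc m)
    S-step m = begin
      (+ m + + 3) * S (suc m)
        ≡⟨ split (+ m) (S (suc m)) ⟩
      (+ m + + 1) * S (suc m) + + 2 * S (suc m)
        ≡⟨ ≡.cong₂ (λ x y → x + + 2 * y) (≡.trans (≡.cong (_* S (suc m)) (≡.sym (+[1+m]≡+m+1 m))) (≡.sym (weighted-symmetric (suc m))))
                                          (S-suc m) ⟩
      (weighted (suc m) + weighted (suc m)) + + 2 * (+ 1 * c (suc m) + shifted m)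
        ≡⟨ ≡.cong (λ w → (w + w) + + 2 * (+ 1 * c (suc m) + shifted m)) (weighted-suc m) ⟩
      ((+ 4 * W + + 2 * S m - T) + (+ 4 * W + + 2 * S m - T)) + + 2 * (+ 1 * c (suc m) + T)
        ≡⟨ regroup W (S m) T (c (suc m)) ⟩
      + 4 * (W + W) + + 4 * S m + + 2 * c (suc m)
        ≡⟨ ≡.cong (λ z → + 4 * z + + 4 * S m + + 2 * c (suc m)) (weighted-symmetric m) ⟩
      + 4 * (+ m * S m) + + 4 * S m + + 2 * c (suc m)
        ≡⟨ factor (+ m) (S m) (c (suc m)) ⟩
      + 4 * (+ m + + 1) * S m + + 2 * c (suc m) ∎
      where
      W = weighted m
      T = shifted m
      split : ∀ (M x : ℤ) → (M + + 3) * x ≡ (M + + 1) * x + + 2 * x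
      split = solve-∀
      regroup : ∀ (W S T c : ℤ) → ((+ 4 * W + + 2 * S - T) + (+ 4 * W + + 2 * S - T)) + + 2 * (+ 1 * c + T) ≡ + 4 * (W + W) + + 4 * S + + 2 * c
      regroup = solve-∀
      factor : ∀ (M S c : ℤ) → + 4 * (M * S) + + 4 * S + + 2 * c ≡ + 4 * (M + + 1) * S + + 2 * c
      factor = solve-∀

  catalan-convolution : ∀ m → catalan-convolution-sum m ≡ c (suc m)
  catalan-convolution zero    = refl
  catalan-convolution (suc m) = ℤP.*-cancelˡ-≡ (+ (3 ℕ.+ m)) (S (suc m)) (c (suc (suc m))) (begin
    + (3 ℕ.+ m) * S (suc m)                          ≡⟨ ≡.cong (_* S (suc m)) (three+ m) ⟩
    (+ m + + 3) * S (suc m)                          ≡⟨ S-step m ⟩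
    + 4 * (+ m + + 1) * S m + + 2 * c (suc m)        ≡⟨ ≡.cong (λ z → + 4 * (+ m + + 1) * z + + 2 * c (suc m)) (catalan-convolution m) ⟩
    + 4 * (+ m + + 1) * c (suc m) + + 2 * c (suc m)  ≡⟨ factor (+ m) (c (suc m)) ⟩
    (+ 2 + + 4 * (+ m + + 1)) * c (suc m)            ≡⟨ ≡.cong (λ z → (+ 2 + + 4 * z) * c (suc m)) (+[1+m]≡+m+1 m) ⟨
    (+ 2 + + 4 * + suc m) * c (suc m)                ≡⟨ catalanℤ-recurrence (suc m) ⟨
    (+ suc m + + 2) * c (suc (suc m))                ≡⟨ ≡.cong (_* c (suc (suc m))) (≡.trans (≡.sym (ℤP.pos-+ (suc m) 2)) (≡.trans (≡.cong ℤ.+_ (ℕP.+-comm (suc m) 2)) (three+ m))) ⟩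
    (+ m + + 3) * c (suc (suc m))                    ≡⟨ ≡.cong (_* c (suc (suc m))) (three+ m) ⟨
    + (3 ℕ.+ m) * c (suc (suc m))                    ∎)
    where
    three+ : ∀ m → + (3 ℕ.+ m) ≡ + m + + 3
    three+ m = ≡.trans (≡.cong ℤ.+_ (ℕP.+-comm 3 m)) (ℤP.pos-+ m 3)
    factor : ∀ (M x : ℤ) → + 4 * (M + + 1) * x + + 2 * x ≡ (+ 2 + + 4 * (M + + 1)) * x
    factor = solve-∀

catalan-equation : catalanℤ ≋ 1ₛ +ₛ svar *ₛ (catalanℤ *ₛ catalanℤ)
catalan-equation zero    = refl
catalan-equation (suc m) = ≡.sym (≡.trans (ℤP.+-identityˡ _)
  (≡.trans (svar-*ₛ (catalanℤ *ₛ catalanℤ) m) (catalan-convolution m)))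

geometric : Series
geometric _ = + 1

geometric-inverse : (1ₛ +ₛ -ₛ svar) *ₛ geometric ≋ 1ₛ
geometric-inverse k = ≡.trans (ℤ[[s]].*ₛ-distribʳ geometric 1ₛ (-ₛ svar) k)
  (≡.trans (≡.cong₂ ℤ._+_ (ℤ[[s]].*ₛ-identityˡ geometric k) (≡.sym (-‿distribˡ-* svar geometric k))) (telescope k))
  where
  open import Algebra.Properties.Ring (CommutativeRing.ring ℤ[[s]].commutativeRing) using (-‿distribˡ-*)
  telescope : ∀ k → + 1 ℤ.+ ℤ.- (svar *ₛ geometric) k ≡ 1ₛ k
  telescope zero    = refl
  telescope (suc k) = ≡.cong (λ z → + 1 ℤ.+ ℤ.- z) (svar-*ₛ geometric k)

negativeBinomial : ℕ → Series
negativeBinomial r j = + ((r ℕ.+ j) C j)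

hockey-stick : ∀ r j → Σ< (suc j) (λ a → + ((r ℕ.+ a) C a)) ≡ + ((suc r ℕ.+ j) C j)
hockey-stick r zero    = refl
hockey-stick r (suc j) = ≡.trans (≡.cong (ℤ._+ + ((r ℕ.+ suc j) C suc j)) (hockey-stick r j))
  (≡.trans (≡.sym (ℤP.pos-+ ((suc r ℕ.+ j) C j) ((r ℕ.+ suc j) C suc j)))
  (≡.cong ℤ.+_ (≡.trans (≡.cong (λ n → (suc r ℕ.+ j) C j ℕ.+ n C suc j) (ℕP.+-suc r j))
               (≡.trans (nCk+nC[k+1]≡[n+1]C[k+1] (suc (r ℕ.+ j)) j) (≡.cong (_C suc j) (≡.sym (ℕP.+-suc (suc r) j)))))))

negativeBinomial≋geometric^ : ∀ r → negativeBinomial r ≋ geometric ^ₛ suc r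
negativeBinomial≋geometric^ zero    j = ≡.trans (≡.cong ℤ.+_ (nCn≡1 j)) (≡.sym (ℤ[[s]].*ₛ-identityʳ geometric j))
negativeBinomial≋geometric^ (suc r) j = begin
  negativeBinomial (suc r) j              ≡⟨ hockey-stick r j ⟨
  Σ< (suc j) (λ a → negativeBinomial r a) ≡⟨ Σ<-cong (suc j) (λ a → ℤP.*-identityʳ _) ⟨
  (negativeBinomial r *ₛ geometric) j     ≡⟨ ℤ[[s]].*ₛ-cong {g = geometric} (negativeBinomial≋geometric^ r) (λ _ → refl) j ⟩
  ((geometric ^ₛ suc r) *ₛ geometric) j   ≡⟨ ℤ[[s]].*ₛ-comm (geometric ^ₛ suc r) geometric j ⟩
  (geometric ^ₛ suc (suc r)) j            ∎
  where open ≡.≡-Reasoning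

Cat : Ser → Ser
Cat σ = compose catalanℤ σ

Cat-equation : ∀ σ → Ord≥ 1 σ → Cat σ ≈ one ⊕ (σ ⊗ (Cat σ ⊗ Cat σ))
Cat-equation σ ord = begin
  compose catalanℤ σ                                                  ≈⟨ compose-cong σ ord catalan-equation ⟩
  compose (1ₛ +ₛ svar *ₛ (catalanℤ *ₛ catalanℤ)) σ                      ≈⟨ compose-+ σ ord 1ₛ (svar *ₛ (catalanℤ *ₛ catalanℤ)) ⟩
  compose 1ₛ σ ⊕ compose (svar *ₛ (catalanℤ *ₛ catalanℤ)) σ             ≈⟨ ⊕-cong (compose-1ₛ σ ord) (≈-trans (compose-* σ ord svar (catalanℤ *ₛ catalanℤ))
                                                                        (⊗-cong (compose-svar σ ord) (compose-* σ ord catalanℤ catalanℤ))) ⟩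
  one ⊕ (σ ⊗ (Cat σ ⊗ Cat σ))                                         ∎
  where open ≈-Reasoning

Geo : Ser → Ser
Geo w = compose geometric w

Geo-inverse : ∀ w → Ord≥ 1 w → (one ⊕ neg w) ⊗ Geo w ≈ one
Geo-inverse w ord = begin
  (one ⊕ neg w) ⊗ Geo w                                  ≈⟨ ⊗-congʳ (Geo w) (⊕-cong (≈-sym (compose-1ₛ w ord))
                                                              (≈-trans (neg-cong (≈-sym (compose-svar w ord))) (≈-sym (compose-neg w ord svar)))) ⟩
  (compose 1ₛ w ⊕ compose (-ₛ svar) w) ⊗ Geo w           ≈⟨ ⊗-congʳ (Geo w) (≈-sym (compose-+ w ord 1ₛ (-ₛ svar))) ⟩
  compose (1ₛ +ₛ -ₛ svar) w ⊗ Geo w                      ≈⟨ compose-* w ord (1ₛ +ₛ -ₛ svar) geometric ⟨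
  compose ((1ₛ +ₛ -ₛ svar) *ₛ geometric) w               ≈⟨ compose-cong w ord geometric-inverse ⟩
  compose 1ₛ w                                           ≈⟨ compose-1ₛ w ord ⟩
  one                                                    ∎
  where open ≈-Reasoning

compose-negativeBinomial : ∀ w → Ord≥ 1 w → ∀ r → compose (negativeBinomial r) w ≈ Geo w ^^ suc r
compose-negativeBinomial w ord r = ≈-trans (compose-cong w ord (negativeBinomial≋geometric^ r)) (compose-^ₛ w ord geometric (suc r))

-- The kernel and its roots Y₁ and X₁

open KernelIdentities Ser-almostCommutativeRing const-homomorphism
  using (kernel; kernel-at-t*g*c; kernel-at-v*t*m*c; kernel-at-1#; kernel-root⇒product-split; kernel-equation; scaled-step)

K : Ser → Ser → Ser
K = kernel tvar

K-cong : ∀ {u u′ v v′} → u ≈ u′ → v ≈ v′ → K u v ≈ K u′ v′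
K-cong u≈u′ v≈v′ = ⊕-cong (⊗-cong u≈u′ v≈v′) (neg-cong (⊗-congˡ tvar
  (⊕-cong (⊗-cong u≈u′ (⊗-cong v≈v′ v≈v′)) (⊕-cong (⊗-cong u≈u′ u≈u′) (⊗-cong v≈v′ v≈v′)))))

Y₁-as-sum : ∀ G → Y₁ G ≈ Σ∞ (λ k → (+ catalan k) · (mono (suc (2 ℕ.* k)) 0 ⊗ (G ⊗ ((one ⊕ G) ^^ k))))
Y₁-as-sum G = coeffs (λ n i → sumTo≡Σ< (suc n) _)

Y₁-closed-form : ∀ G → Y₁ G ≈ tvar ⊗ (G ⊗ Cat ((tvar ⊗ tvar) ⊗ (one ⊕ G)))
Y₁-closed-form G = begin
  Y₁ G                                                 ≈⟨ Y₁-as-sum G ⟩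
  Σ∞ (λ k → (+ catalan k) · (mono (suc (2 ℕ.* k)) 0 ⊗ (G ⊗ ((one ⊕ G) ^^ k))))
                                                       ≈⟨ Σ∞-cong (λ k → ·-congʳ (+ catalan k) (term k)) ⟩
  Σ∞ (λ k → (+ catalan k) · ((tvar ⊗ G) ⊗ (σ ^^ k)))  ≈⟨ Σ∞-cong (λ k → ≈-sym (⊗-· (+ catalan k) (tvar ⊗ G) (σ ^^ k))) ⟩
  Σ∞ (λ k → (tvar ⊗ G) ⊗ ((+ catalan k) · (σ ^^ k)))  ≈⟨ ⊗-distribˡ-Σ∞ (λ k → (+ catalan k) · (σ ^^ k)) (compose-summable σ ord-σ catalanℤ) (tvar ⊗ G) ⟨
  (tvar ⊗ G) ⊗ Cat σ                                   ≈⟨ ⊗-assoc tvar G (Cat σ) ⟩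
  tvar ⊗ (G ⊗ Cat σ)                                   ∎
  where
  open ≈-Reasoning
  σ = (tvar ⊗ tvar) ⊗ (one ⊕ G)
  ord-σ : Ord≥ 1 σ
  ord-σ = Ord≥1-tvar²⊗ (one ⊕ G)
  term : ∀ k → mono (suc (2 ℕ.* k)) 0 ⊗ (G ⊗ ((one ⊕ G) ^^ k)) ≈ (tvar ⊗ G) ⊗ (σ ^^ k)
  term k = begin
    mono (suc (2 ℕ.* k)) 0 ⊗ (G ⊗ ((one ⊕ G) ^^ k))              ≈⟨ ⊗-congʳ (G ⊗ ((one ⊕ G) ^^ k)) (≈-trans (mono≈t^ (suc (2 ℕ.* k))) (^^-odd tvar k)) ⟩
    (tvar ⊗ ((tvar ⊗ tvar) ^^ k)) ⊗ (G ⊗ ((one ⊕ G) ^^ k))       ≈⟨ solve 4 (λ t P g q → (t :* P) :* (g :* q) := (t :* g) :* (P :* q)) ≈-refl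
                                                                       tvar ((tvar ⊗ tvar) ^^ k) G ((one ⊕ G) ^^ k) ⟩
    (tvar ⊗ G) ⊗ (((tvar ⊗ tvar) ^^ k) ⊗ ((one ⊕ G) ^^ k))       ≈⟨ ⊗-congˡ (tvar ⊗ G) (^^-⊗ (tvar ⊗ tvar) (one ⊕ G) k) ⟨
    (tvar ⊗ G) ⊗ (σ ^^ k)                                        ∎


K-root-t⊗G⊗c : ∀ G c → c ≈ one ⊕ (((tvar ⊗ tvar) ⊗ (one ⊕ G)) ⊗ (c ⊗ c)) → K G (tvar ⊗ (G ⊗ c)) ≈ zeroS
K-root-t⊗G⊗c G c catalan-eq = ≈-trans (kernel-at-t*g*c tvar G c) (≈-trans
  (⊗-congˡ (tvar ⊗ (G ⊗ G)) (≈-trans (⊕-congʳ (neg R) catalan-eq) (neg-inverseʳ R)))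
  (⊗-zeroʳ (tvar ⊗ (G ⊗ G))))
  where R = one ⊕ (((tvar ⊗ tvar) ⊗ (one ⊕ G)) ⊗ (c ⊗ c))

K-Y₁ : ∀ G → K G (Y₁ G) ≈ zeroS
K-Y₁ G = ≈-trans (K-cong (≈-refl {G}) (Y₁-closed-form G))
  (K-root-t⊗G⊗c G (Cat ((tvar ⊗ tvar) ⊗ (one ⊕ G))) (Cat-equation ((tvar ⊗ tvar) ⊗ (one ⊕ G)) (Ord≥1-tvar²⊗ (one ⊕ G))))

τ : Ser → Ser
τ v = tvar ⊗ Geo (tvar ⊗ v)

X₁-term : Ser → ℕ → ℕ → Ser
X₁-term v k j = (+ (catalan k ℕ.* ((2 ℕ.* k ℕ.+ j) C j))) · (mono (suc (2 ℕ.* k ℕ.+ j)) 0 ⊗ (v ^^ suc j))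

X₁-as-sum : ∀ v → X₁ v ≈ Σ∞ (λ k → Σ∞ (X₁-term v k))
X₁-as-sum v = coeffs (λ n i → ≡.trans (sumTo≡Σ< (suc n) _) (Σ<-cong (suc n) (λ k → sumTo≡Σ< (suc n) _)))

X₁-term-factor : ∀ v k j → X₁-term v k j ≈
  catalanℤ k · ((v ⊗ (tvar ^^ suc (2 ℕ.* k))) ⊗ (negativeBinomial (2 ℕ.* k) j · ((tvar ⊗ v) ^^ j)))
X₁-term-factor v k j = ≈-sym (begin
  catalanℤ k · ((v ⊗ T) ⊗ (negativeBinomial (2 ℕ.* k) j · ((tvar ⊗ v) ^^ j)))
    ≈⟨ ·-congʳ (catalanℤ k) (⊗-· (negativeBinomial (2 ℕ.* k) j) (v ⊗ T) ((tvar ⊗ v) ^^ j)) ⟩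
  catalanℤ k · (negativeBinomial (2 ℕ.* k) j · ((v ⊗ T) ⊗ ((tvar ⊗ v) ^^ j)))
    ≈⟨ ·-assoc (catalanℤ k) (negativeBinomial (2 ℕ.* k) j) ((v ⊗ T) ⊗ ((tvar ⊗ v) ^^ j)) ⟩
  (catalanℤ k ℤ.* negativeBinomial (2 ℕ.* k) j) · ((v ⊗ T) ⊗ ((tvar ⊗ v) ^^ j))
    ≈⟨ ·-cong (≡.sym (ℤP.pos-* (catalan k) ((2 ℕ.* k ℕ.+ j) C j))) monomial ⟩
  X₁-term v k j ∎)
  where
  open ≈-Reasoning
  T = tvar ^^ suc (2 ℕ.* k)
  monomial : (v ⊗ T) ⊗ ((tvar ⊗ v) ^^ j) ≈ mono (suc (2 ℕ.* k ℕ.+ j)) 0 ⊗ (v ^^ suc j)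
  monomial = ≈-sym (begin
    mono (suc (2 ℕ.* k ℕ.+ j)) 0 ⊗ (v ^^ suc j)
      ≈⟨ ⊗-congʳ (v ^^ suc j) (≈-trans (mono≈t^ (suc (2 ℕ.* k ℕ.+ j))) (^^-+ tvar (suc (2 ℕ.* k)) j)) ⟩
    (T ⊗ (tvar ^^ j)) ⊗ (v ⊗ (v ^^ j))
      ≈⟨ solve 4 (λ a b x y → (a :* b) :* (x :* y) := (x :* a) :* (b :* y)) ≈-refl T (tvar ^^ j) v (v ^^ j) ⟩
    (v ⊗ T) ⊗ ((tvar ^^ j) ⊗ (v ^^ j))
      ≈⟨ ⊗-congˡ (v ⊗ T) (^^-⊗ tvar v j) ⟨
    (v ⊗ T) ⊗ ((tvar ⊗ v) ^^ j) ∎)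

X₁-row : ∀ v k → Σ∞ (X₁-term v k) ≈ v ⊗ (catalanℤ k · (τ v ⊗ ((τ v ⊗ τ v) ^^ k)))
X₁-row v k = begin
  Σ∞ (X₁-term v k)
    ≈⟨ Σ∞-cong (X₁-term-factor v k) ⟩
  Σ∞ (λ j → catalanℤ k · ((v ⊗ T) ⊗ (negativeBinomial (2 ℕ.* k) j · ((tvar ⊗ v) ^^ j))))
    ≈⟨ Σ∞-· (catalanℤ k) (λ j → (v ⊗ T) ⊗ (negativeBinomial (2 ℕ.* k) j · ((tvar ⊗ v) ^^ j))) ⟩
  catalanℤ k · Σ∞ (λ j → (v ⊗ T) ⊗ (negativeBinomial (2 ℕ.* k) j · ((tvar ⊗ v) ^^ j)))
    ≈⟨ ·-congʳ (catalanℤ k) (⊗-distribˡ-Σ∞ (λ j → negativeBinomial (2 ℕ.* k) j · ((tvar ⊗ v) ^^ j))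
                                           (compose-summable (tvar ⊗ v) (Ord≥1-tvar⊗ v) (negativeBinomial (2 ℕ.* k))) (v ⊗ T)) ⟨
  catalanℤ k · ((v ⊗ T) ⊗ compose (negativeBinomial (2 ℕ.* k)) (tvar ⊗ v))
    ≈⟨ ·-congʳ (catalanℤ k) (⊗-assoc v T (compose (negativeBinomial (2 ℕ.* k)) (tvar ⊗ v))) ⟩
  catalanℤ k · (v ⊗ (T ⊗ compose (negativeBinomial (2 ℕ.* k)) (tvar ⊗ v)))
    ≈⟨ ·-congʳ (catalanℤ k) (⊗-congˡ v (⊗-congˡ T (compose-negativeBinomial (tvar ⊗ v) (Ord≥1-tvar⊗ v) (2 ℕ.* k)))) ⟩
  catalanℤ k · (v ⊗ (T ⊗ (Geo (tvar ⊗ v) ^^ suc (2 ℕ.* k))))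
    ≈⟨ ·-congʳ (catalanℤ k) (⊗-congˡ v (≈-trans (≈-sym (^^-⊗ tvar (Geo (tvar ⊗ v)) (suc (2 ℕ.* k)))) (^^-odd (τ v) k))) ⟩
  catalanℤ k · (v ⊗ (τ v ⊗ ((τ v ⊗ τ v) ^^ k)))
    ≈⟨ ⊗-· (catalanℤ k) v (τ v ⊗ ((τ v ⊗ τ v) ^^ k)) ⟨
  v ⊗ (catalanℤ k · (τ v ⊗ ((τ v ⊗ τ v) ^^ k))) ∎
  where
  open ≈-Reasoning
  T = tvar ^^ suc (2 ℕ.* k)

τ-def : ∀ v → τ v ≈ tvar ⊗ Geo (tvar ⊗ v)
τ-def v = ≈-refl

Ord≥-τ⊗τ : ∀ v → Ord≥ 1 (τ v ⊗ τ v)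
Ord≥-τ⊗τ v = Ord≥-⊗ˡ (τ v) (τ v) (Ord≥1-tvar⊗ (Geo (tvar ⊗ v)))

X₁-closed-form : ∀ v → X₁ v ≈ v ⊗ (τ v ⊗ Cat (τ v ⊗ τ v))
X₁-closed-form v = begin
  X₁ v                                                         ≈⟨ X₁-as-sum v ⟩
  Σ∞ (λ k → Σ∞ (X₁-term v k))                                  ≈⟨ Σ∞-cong (X₁-row v) ⟩
  Σ∞ (λ k → v ⊗ (catalanℤ k · (τ v ⊗ ((τ v ⊗ τ v) ^^ k))))      ≈⟨ ⊗-distribˡ-Σ∞ (λ k → catalanℤ k · (τ v ⊗ ((τ v ⊗ τ v) ^^ k))) summable v ⟨
  v ⊗ Σ∞ (λ k → catalanℤ k · (τ v ⊗ ((τ v ⊗ τ v) ^^ k)))        ≈⟨ ⊗-congˡ v (Σ∞-cong (λ k → ⊗-· (catalanℤ k) (τ v) ((τ v ⊗ τ v) ^^ k))) ⟨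
  v ⊗ Σ∞ (λ k → τ v ⊗ (catalanℤ k · ((τ v ⊗ τ v) ^^ k)))        ≈⟨ ⊗-congˡ v (⊗-distribˡ-Σ∞ (λ k → catalanℤ k · ((τ v ⊗ τ v) ^^ k))
                                                                     (compose-summable (τ v ⊗ τ v) (Ord≥-τ⊗τ v) catalanℤ) (τ v)) ⟨
  v ⊗ (τ v ⊗ Cat (τ v ⊗ τ v))                                  ∎
  where
  open ≈-Reasoning
  summable : Summable (λ k → catalanℤ k · (τ v ⊗ ((τ v ⊗ τ v) ^^ k)))
  summable k = Ord≥-· (catalanℤ k) (τ v ⊗ ((τ v ⊗ τ v) ^^ k))
                      (Ord≥-⊗ʳ (τ v) ((τ v ⊗ τ v) ^^ k) (Ord≥-^^ (τ v ⊗ τ v) (Ord≥-τ⊗τ v) k))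

K-root-v⊗t⊗M⊗c : ∀ v M c → (one ⊕ neg (tvar ⊗ v)) ⊗ M ≈ one →
                 c ≈ one ⊕ (((tvar ⊗ M) ⊗ (tvar ⊗ M)) ⊗ (c ⊗ c)) → K (v ⊗ ((tvar ⊗ M) ⊗ c)) v ≈ zeroS
K-root-v⊗t⊗M⊗c v M c geometric-eq catalan-eq = ≈-trans (kernel-at-v*t*m*c tvar v M c) (≈-trans
  (⊗-congˡ ((v ⊗ v) ⊗ tvar) (≈-trans (⊕-cong
    (≈-trans (⊗-congˡ c (≈-trans (⊕-congʳ (neg one) geometric-eq) (neg-inverseʳ one))) (⊗-zeroʳ c))
    (≈-trans (⊕-congʳ (neg R) catalan-eq) (neg-inverseʳ R))) (⊕-identityˡ zeroS)))
  (⊗-zeroʳ ((v ⊗ v) ⊗ tvar)))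
  where R = one ⊕ (((tvar ⊗ M) ⊗ (tvar ⊗ M)) ⊗ (c ⊗ c))

K-X₁ : ∀ v → K (X₁ v) v ≈ zeroS
K-X₁ v = ≈-trans (K-cong (≈-trans (X₁-closed-form v) (⊗-congˡ v (⊗-congʳ (Cat (τ v ⊗ τ v)) (τ-def v)))) (≈-refl {v}))
  (K-root-v⊗t⊗M⊗c v (Geo (tvar ⊗ v)) (Cat (τ v ⊗ τ v)) (Geo-inverse (tvar ⊗ v) (Ord≥1-tvar⊗ v))
    (≈-trans (Cat-equation (τ v ⊗ τ v) (Ord≥-τ⊗τ v)) (⊕-congˡ one (⊗-congʳ (Cat (τ v ⊗ τ v) ⊗ Cat (τ v ⊗ τ v)) (⊗-cong (τ-def v) (τ-def v))))))

-- Quarter-plane walks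

module _ where
  open import Data.Nat using (_+_)

  sum-map-+ : ∀ {X : Set} (f g : X → ℕ) xs → sum (map (λ x → f x + g x) xs) ≡ sum (map f xs) + sum (map g xs)
  sum-map-+ f g []       = refl
  sum-map-+ f g (x ∷ xs) = ≡.trans (≡.cong (λ s → f x + g x + s) (sum-map-+ f g xs)) (interchange (f x) (g x) _ _)
    where
    interchange : ∀ a b c d → a + b + (c + d) ≡ a + c + (b + d)
    interchange = ℕ-Solver.solve-∀

  sum-map-0 : ∀ {X : Set} (xs : List X) → sum (map (λ _ → 0) xs) ≡ 0
  sum-map-0 []       = refl
  sum-map-0 (x ∷ xs) = sum-map-0 xs

  sum-map-cong : ∀ {X : Set} {f g : X → ℕ} xs → (∀ x → f x ≡ g x) → sum (map f xs) ≡ sum (map g xs)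
  sum-map-cong xs f≡g = ≡.cong sum (ListP.map-cong f≡g xs)

  sum-map-concatMap : ∀ {X Y : Set} (h : Y → ℕ) (f : X → List Y) xs →
                      sum (map h (concatMap f xs)) ≡ sum (map (λ x → sum (map h (f x))) xs)
  sum-map-concatMap h f []       = refl
  sum-map-concatMap h f (x ∷ xs) = ≡.trans (≡.cong sum (ListP.map-++ h (f x) (concatMap f xs)))
    (≡.trans (sum-++ (map h (f x)) _) (≡.cong (λ s → sum (map h (f x)) + s) (sum-map-concatMap h f xs)))

  sum-map-if : ∀ {X : Set} (b : Bool) (f : X → ℕ) xs →
               sum (map (λ x → if b then f x else 0) xs) ≡ (if b then sum (map f xs) else 0)
  sum-map-if true  f xs = refl
  sum-map-if false f xs = sum-map-0 xs

  length-filter : ∀ {X : Set} {P : Pred X 0ℓ} (P? : Decidable P) xs →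
                  length (filter P? xs) ≡ sum (map (λ x → if does (P? x) then 1 else 0) xs)
  length-filter P? []       = refl
  length-filter P? (x ∷ xs) with does (P? x)
  ... | false = length-filter P? xs
  ... | true  = ≡.cong suc (length-filter P? xs)

  length-filter-filter : ∀ {X : Set} {P Q : Pred X 0ℓ} (P? : Decidable P) (Q? : Decidable Q) xs →
    length (filter Q? (filter P? xs)) ≡ sum (map (λ x → if does (P? x) then (if does (Q? x) then 1 else 0) else 0) xs)
  length-filter-filter P? Q? []       = refl
  length-filter-filter P? Q? (x ∷ xs) with does (P? x)
  ... | false = length-filter-filter P? Q? xs
  ... | true with does (Q? x)
  ...   | true  = ≡.cong suc (length-filter-filter P? Q? xs)
  ...   | false = length-filter-filter P? Q? xs

Point : Set
Point = ℤ × ℤ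

origin : Point
origin = + 0 , + 0

admissible : Point → Step → Bool
admissible (a , b) s = does ((+ 0 ℤ.≤? a ℤ.+ proj₁ (Δ s)) ×-dec (+ 0 ℤ.≤? b ℤ.+ proj₂ (Δ s)))

move : Point → Step → Point
move (a , b) s = a ℤ.+ proj₁ (Δ s) , b ℤ.+ proj₂ (Δ s)

weight : Point → (Point → ℕ) → List Step → ℕ
weight p G w = if does (staysIn? p w) then G (endpoint p w) else 0

walkSum : ℕ → Point → (Point → ℕ) → ℕ
walkSum k p G = sum (map (weight p G) (allWalks k))

module _ where
  open import Data.Nat using (_+_)

  Σ-steps : (Step → ℕ) → ℕ
  Σ-steps h = h nw + (h north + (h se + 0))

  Σ-steps-cong : ∀ {h h′} → (∀ s → h s ≡ h′ s) → Σ-steps h ≡ Σ-steps h′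
  Σ-steps-cong h≡h′ = ≡.cong₂ _+_ (h≡h′ nw) (≡.cong₂ _+_ (h≡h′ north) (≡.cong (_+ 0) (h≡h′ se)))

  if-∧ : ∀ {X : Set} (b c : Bool) {x y : X} → (if b ∧ c then x else y) ≡ (if b then (if c then x else y) else y)
  if-∧ true  c = refl
  if-∧ false c = refl

  weight-∷ : ∀ p G s w → weight p G (s ∷ w) ≡ (if admissible p s then weight (move p s) G w else 0)
  weight-∷ (a , b) G nw    w = if-∧ (admissible (a , b) nw) _
  weight-∷ (a , b) G north w = if-∧ (admissible (a , b) north) _
  weight-∷ (a , b) G se    w = if-∧ (admissible (a , b) se) _


  walkSum-zero : ∀ p G → walkSum 0 p G ≡ G p
  walkSum-zero (a , b) G = ℕP.+-identityʳ (G (a , b))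

  walkSum-suc : ∀ k p G → walkSum (suc k) p G ≡ Σ-steps (λ s → if admissible p s then walkSum k (move p s) G else 0)
  walkSum-suc k p G = begin
    sum (map (weight p G) (concatMap (λ w → (nw ∷ w) ∷ (north ∷ w) ∷ (se ∷ w) ∷ []) (allWalks k)))
      ≡⟨ sum-map-concatMap (weight p G) _ (allWalks k) ⟩
    sum (map (λ w → Σ-steps (λ s → weight p G (s ∷ w))) (allWalks k))
      ≡⟨ sum-map-cong (allWalks k) (λ w → Σ-steps-cong (λ s → weight-∷ p G s w)) ⟩
    sum (map (λ w → Σ-steps (λ s → if admissible p s then weight (move p s) G w else 0)) (allWalks k))
      ≡⟨ sum-map-Σ-steps (λ w s → if admissible p s then weight (move p s) G w else 0) (allWalks k) ⟩
    Σ-steps (λ s → sum (map (λ w → if admissible p s then weight (move p s) G w else 0) (allWalks k)))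
      ≡⟨ Σ-steps-cong (λ s → sum-map-if (admissible p s) (weight (move p s) G) (allWalks k)) ⟩
    Σ-steps (λ s → if admissible p s then walkSum k (move p s) G else 0) ∎
    where
    open ≡.≡-Reasoning
    sum-map-Σ-steps : ∀ (h : List Step → Step → ℕ) ws → sum (map (λ w → Σ-steps (h w)) ws) ≡ Σ-steps (λ s → sum (map (λ w → h w s) ws))
    sum-map-Σ-steps h ws = ≡.trans (sum-map-+ _ _ ws) (≡.cong₂ _+_ refl
      (≡.trans (sum-map-+ _ _ ws) (≡.cong₂ _+_ refl (≡.trans (sum-map-+ _ _ ws) (≡.cong₂ _+_ refl (sum-map-0 ws))))))

  after-step : (Point → ℕ) → Point → ℕ
  after-step G e = Σ-steps (λ s → if admissible e s then G (move e s) else 0)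

  if-cong : ∀ (b : Bool) {x y : ℕ} → x ≡ y → (if b then x else 0) ≡ (if b then y else 0)
  if-cong b refl = refl

  walkSum-suc-last : ∀ k p G → walkSum (suc k) p G ≡ walkSum k p (after-step G)
  walkSum-suc-last zero    p G = ≡.trans (walkSum-suc 0 p G)
    (≡.trans (Σ-steps-cong (λ s → if-cong (admissible p s) (walkSum-zero (move p s) G))) (≡.sym (walkSum-zero p (after-step G))))
  walkSum-suc-last (suc k) p G = ≡.trans (walkSum-suc (suc k) p G)
    (≡.trans (Σ-steps-cong (λ s → if-cong (admissible p s) (walkSum-suc-last k (move p s) G))) (≡.sym (walkSum-suc k p (after-step G))))

  walkSum-+ : ∀ k p G H → walkSum k p (λ e → G e + H e) ≡ walkSum k p G + walkSum k p H
  walkSum-+ k p G H = ≡.trans (sum-map-cong (allWalks k) weight-+) (sum-map-+ _ _ (allWalks k))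
    where
    weight-+ : ∀ w → weight p (λ e → G e + H e) w ≡ weight p G w + weight p H w
    weight-+ w with does (staysIn? p w)
    ... | true  = refl
    ... | false = refl

  walkSum-0 : ∀ k p → walkSum k p (λ _ → 0) ≡ 0
  walkSum-0 k p = ≡.trans (sum-map-cong (allWalks k) weight-0) (sum-map-0 (allWalks k))
    where
    weight-0 : ∀ w → weight p (λ _ → 0) w ≡ 0
    weight-0 w with does (staysIn? p w)
    ... | true  = refl
    ... | false = refl

  walkSum-cong : ∀ k p {G H} → (∀ e → G e ≡ H e) → walkSum k p G ≡ walkSum k p H
  walkSum-cong k p {G} {H} G≡H = sum-map-cong (allWalks k) weight-cong
    where
    weight-cong : ∀ w → weight p G w ≡ weight p H w
    weight-cong w with does (staysIn? p w)
    ... | true  = G≡H _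
    ... | false = refl

  walkSum-local : ∀ k a b (G H : Point → ℕ) → (∀ a′ b′ → a′ + b′ ≤ a + b + k → G (+ a′ , + b′) ≡ H (+ a′ , + b′)) →
                  walkSum k (+ a , + b) G ≡ walkSum k (+ a , + b) H
  walkSum-local zero    a b G H G≡H = ≡.trans (walkSum-zero _ G)
    (≡.trans (G≡H a b (ℕP.≤-reflexive (≡.sym (ℕP.+-identityʳ (a + b))))) (≡.sym (walkSum-zero _ H)))
  walkSum-local (suc k) a b G H G≡H = ≡.trans (walkSum-suc k _ G)
    (≡.trans (≡.cong₂ _+_ (via-nw a G≡H) (≡.cong₂ _+_ via-north (≡.cong (_+ 0) (via-se b G≡H)))) (≡.sym (walkSum-suc k _ H)))
    where
    open ℕ-Solver using (solve-∀)
    shift-nw : ∀ a b k → suc (a + (b + 1) + k) ≡ suc a + b + suc k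
    shift-nw = solve-∀
    shift-north : ∀ a b k → a + 0 + (b + 1) + k ≡ a + b + suc k
    shift-north = solve-∀
    shift-se : ∀ a b k → suc (a + 1 + b + k) ≡ a + suc b + suc k
    shift-se = solve-∀
    Step-ok : ℕ → ℕ → Set
    Step-ok a b = ∀ a′ b′ → a′ + b′ ≤ a + b + suc k → G (+ a′ , + b′) ≡ H (+ a′ , + b′)
    via-nw : ∀ a → Step-ok a b → (if admissible (+ a , + b) nw then walkSum k (move (+ a , + b) nw) G else 0)
                              ≡ (if admissible (+ a , + b) nw then walkSum k (move (+ a , + b) nw) H else 0)
    via-nw zero    _   = refl
    via-nw (suc a) ok = walkSum-local k a (b + 1) G H (λ a′ b′ p → ok a′ b′ (ℕP.≤-trans p (ℕP.≤-trans (ℕP.n≤1+n _) (ℕP.≤-reflexive (shift-nw a b k)))))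
    via-north : (if admissible (+ a , + b) north then walkSum k (move (+ a , + b) north) G else 0)
              ≡ (if admissible (+ a , + b) north then walkSum k (move (+ a , + b) north) H else 0)
    via-north = walkSum-local k (a + 0) (b + 1) G H (λ a′ b′ p → G≡H a′ b′ (ℕP.≤-trans p (ℕP.≤-reflexive (shift-north a b k))))
    via-se : ∀ b → Step-ok a b → (if admissible (+ a , + b) se then walkSum k (move (+ a , + b) se) G else 0)
                              ≡ (if admissible (+ a , + b) se then walkSum k (move (+ a , + b) se) H else 0)
    via-se zero    _  = refl
    via-se (suc b) ok = walkSum-local k (a + 1) b G H (λ a′ b′ p → ok a′ b′ (ℕP.≤-trans p (ℕP.≤-trans (ℕP.n≤1+n _) (ℕP.≤-reflexive (shift-se a b k)))))

onℕ² : (ℕ → ℕ → ℕ) → Point → ℕ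
onℕ² g (+ a , + b)      = g a b
onℕ² g (+ a , -[1+ b ]) = 0
onℕ² g (-[1+ a ] , _)   = 0

infix 4 _==_

_==_ : ℕ → ℕ → Bool
a == i = does (+ a ℤ.≟ + i)

==-refl : ∀ a → (a == a) ≡ true
==-refl zero    = refl
==-refl (suc a) = ==-refl a

≢⇒==-false : ∀ {a i} → a ≢ i → (a == i) ≡ false
≢⇒==-false {zero}  {zero}  a≢i = ⊥-elim (a≢i refl)
≢⇒==-false {zero}  {suc i} a≢i = refl
≢⇒==-false {suc a} {zero}  a≢i = refl
≢⇒==-false {suc a} {suc i} a≢i = ≢⇒==-false (a≢i ∘ ≡.cong suc)

indicator : ℕ → ℕ → ℕ → ℕ → ℕ
indicator i j a b = if (a == i) ∧ (b == j) then 1 else 0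

indicator-off : ∀ i j a b → a ≢ i ⊎ b ≢ j → indicator i j a b ≡ 0
indicator-off i j a b (inj₁ a≢i) rewrite ≢⇒==-false a≢i = refl
indicator-off i j a b (inj₂ b≢j) rewrite ≢⇒==-false b≢j with a == i
... | true  = refl
... | false = refl

quarterSum : ℕ → (ℕ → ℕ → ℕ) → ℕ
quarterSum k g = walkSum k origin (onℕ² g)

q≡quarterSum-indicator : ∀ k i j → q k i j ≡ quarterSum k (indicator i j)
q≡quarterSum-indicator k i j = ≡.trans (length-filter-filter (staysIn? origin) (endsAt? i j) (allWalks k))
                                       (sum-map-cong (allWalks k) per-walk)
  where
  ends-at : ∀ w → (if does (endsAt? i j w) then 1 else 0) ≡ onℕ² (indicator i j) (endpoint origin w)
  ends-at w with endpoint origin w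
  ... | (+ a , + b) with + a ℤ.≟ + i | + b ℤ.≟ + j
  ...   | yes refl | yes refl rewrite ==-refl a | ==-refl b = refl
  ...   | yes refl | no b≢j   = ≡.sym (indicator-off i j a b (inj₂ (b≢j ∘ ≡.cong +_)))
  ...   | no a≢i   | _        = ≡.sym (indicator-off i j a b (inj₁ (a≢i ∘ ≡.cong +_)))
  ends-at w | (+ a , -[1+ b ]) with + a ℤ.≟ + i
  ...   | yes _ = refl
  ...   | no _  = refl
  ends-at w | (-[1+ a ] , _) = refl
  per-walk : ∀ w → (if does (staysIn? origin w) then (if does (endsAt? i j w) then 1 else 0) else 0)
                   ≡ weight origin (onℕ² (indicator i j)) w
  per-walk w with does (staysIn? origin w)
  ... | true  = ends-at w
  ... | false = refl

module _ where
  open import Data.Nat using (_+_)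

  ==-suc : ∀ b j → (b + 1 == suc j) ≡ (b == j)
  ==-suc b j = ≡.cong (_== suc j) (ℕP.+-comm b 1)

  suc==0 : ∀ b → (b + 1 == 0) ≡ false
  suc==0 b = ≡.cong (_== 0) (ℕP.+-comm b 1)

  ==-+0 : ∀ a i → (a + 0 == i) ≡ (a == i)
  ==-+0 a i = ≡.cong (_== i) (ℕP.+-identityʳ a)

  indicator-cong : ∀ {x y} → x ≡ y → (if x then 1 else 0) ≡ (if y then 1 else 0)
  indicator-cong refl = refl

  from-nw from-north from-se : ℕ → ℕ → ℕ → ℕ → ℕ
  from-nw i j zero    b = 0
  from-nw i j (suc a) b = indicator i j a (b + 1)
  from-north i j a b = indicator i j (a + 0) (b + 1)
  from-se i j a zero    = 0
  from-se i j a (suc b) = indicator i j (a + 1) b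

  after-step-indicator : ∀ i j a b → after-step (onℕ² (indicator i j)) (+ a , + b) ≡ from-nw i j a b + (from-north i j a b + (from-se i j a b + 0))
  after-step-indicator i j zero    zero    = refl
  after-step-indicator i j zero    (suc b) = refl
  after-step-indicator i j (suc a) zero    = refl
  after-step-indicator i j (suc a) (suc b) = refl

  quarterSum-+ : ∀ k f g → quarterSum k (λ a b → f a b + g a b) ≡ quarterSum k f + quarterSum k g
  quarterSum-+ k f g = ≡.trans (walkSum-cong k origin onℕ²-+) (walkSum-+ k origin (onℕ² f) (onℕ² g))
    where
    onℕ²-+ : ∀ e → onℕ² (λ a b → f a b + g a b) e ≡ onℕ² f e + onℕ² g e
    onℕ²-+ (+ a , + b)      = refl
    onℕ²-+ (+ a , -[1+ b ]) = refl
    onℕ²-+ (-[1+ a ] , _)   = refl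

  quarterSum-0 : ∀ k → quarterSum k (λ _ _ → 0) ≡ 0
  quarterSum-0 k = ≡.trans (walkSum-cong k origin onℕ²-0) (walkSum-0 k origin)
    where
    onℕ²-0 : ∀ e → onℕ² (λ _ _ → 0) e ≡ 0
    onℕ²-0 (+ a , + b)      = refl
    onℕ²-0 (+ a , -[1+ b ]) = refl
    onℕ²-0 (-[1+ a ] , _)   = refl

  quarterSum-cong : ∀ k {f g} → (∀ a b → f a b ≡ g a b) → quarterSum k f ≡ quarterSum k g
  quarterSum-cong k f≡g = walkSum-cong k origin onℕ²-cong
    where
    onℕ²-cong : ∀ e → onℕ² _ e ≡ onℕ² _ e
    onℕ²-cong (+ a , + b)      = f≡g a b
    onℕ²-cong (+ a , -[1+ b ]) = refl
    onℕ²-cong (-[1+ a ] , _)   = refl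

  q-via-nw q-via-north q-via-se : ℕ → ℕ → ℕ → ℕ
  q-via-nw    k i zero    = 0
  q-via-nw    k i (suc j) = q k (suc i) j
  q-via-north k i zero    = 0
  q-via-north k i (suc j) = q k i j
  q-via-se    k zero    j = 0
  q-via-se    k (suc i) j = q k i (suc j)

  quarterSum-from-nw : ∀ k i j → quarterSum k (from-nw i j) ≡ q-via-nw k i j
  quarterSum-from-nw k i zero    = ≡.trans (quarterSum-cong k vanish) (quarterSum-0 k)
    where
    vanish : ∀ a b → from-nw i 0 a b ≡ 0
    vanish zero    b = refl
    vanish (suc a) b = indicator-cong (≡.trans (≡.cong ((a == i) ∧_) (suc==0 b)) (∧-zeroʳ (a == i)))
  quarterSum-from-nw k i (suc j) = ≡.trans (quarterSum-cong k shift) (≡.sym (q≡quarterSum-indicator k (suc i) j))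
    where
    shift : ∀ a b → from-nw i (suc j) a b ≡ indicator (suc i) j a b
    shift zero    b = refl
    shift (suc a) b = indicator-cong (≡.cong ((a == i) ∧_) (==-suc b j))

  quarterSum-from-north : ∀ k i j → quarterSum k (from-north i j) ≡ q-via-north k i j
  quarterSum-from-north k i zero    = ≡.trans (quarterSum-cong k vanish) (quarterSum-0 k)
    where
    vanish : ∀ a b → from-north i 0 a b ≡ 0
    vanish a b = indicator-cong (≡.trans (≡.cong ((a + 0 == i) ∧_) (suc==0 b)) (∧-zeroʳ (a + 0 == i)))
  quarterSum-from-north k i (suc j) = ≡.trans (quarterSum-cong k shift) (≡.sym (q≡quarterSum-indicator k i j))
    where
    shift : ∀ a b → from-north i (suc j) a b ≡ indicator i j a b
    shift a b = indicator-cong (≡.cong₂ _∧_ (==-+0 a i) (==-suc b j))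

  quarterSum-from-se : ∀ k i j → quarterSum k (from-se i j) ≡ q-via-se k i j
  quarterSum-from-se k zero    j = ≡.trans (quarterSum-cong k vanish) (quarterSum-0 k)
    where
    vanish : ∀ a b → from-se 0 j a b ≡ 0
    vanish a zero    = refl
    vanish a (suc b) = indicator-cong (≡.cong (_∧ (b == j)) (suc==0 a))
  quarterSum-from-se k (suc i) j = ≡.trans (quarterSum-cong k shift) (≡.sym (q≡quarterSum-indicator k i (suc j)))
    where
    shift : ∀ a b → from-se (suc i) j a b ≡ indicator i (suc j) a b
    shift a zero    = indicator-cong (≡.sym (∧-zeroʳ (a == i)))
    shift a (suc b) = indicator-cong (≡.cong (_∧ (b == j)) (==-suc a i))

  q-suc : ∀ k i j → q (suc k) i j ≡ q-via-nw k i j + (q-via-north k i j + (q-via-se k i j + 0))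
  q-suc k i j = begin
    q (suc k) i j
      ≡⟨ q≡quarterSum-indicator (suc k) i j ⟩
    walkSum (suc k) origin (onℕ² (indicator i j))
      ≡⟨ walkSum-suc-last k origin (onℕ² (indicator i j)) ⟩
    walkSum k origin (after-step (onℕ² (indicator i j)))
      ≡⟨ walkSum-local k 0 0 (after-step (onℕ² (indicator i j))) (onℕ² (λ a b → from-nw i j a b + (from-north i j a b + (from-se i j a b + 0))))
                       (λ a b _ → after-step-indicator i j a b) ⟩
    quarterSum k (λ a b → from-nw i j a b + (from-north i j a b + (from-se i j a b + 0)))
      ≡⟨ ≡.trans (quarterSum-+ k (from-nw i j) _) (≡.cong₂ _+_ refl (≡.trans (quarterSum-+ k (from-north i j) _)
           (≡.cong₂ _+_ refl (≡.trans (quarterSum-+ k (from-se i j) _) (≡.cong₂ _+_ refl (quarterSum-0 k)))))) ⟩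
    quarterSum k (from-nw i j) + (quarterSum k (from-north i j) + (quarterSum k (from-se i j) + 0))
      ≡⟨ ≡.cong₂ _+_ (quarterSum-from-nw k i j) (≡.cong₂ _+_ (quarterSum-from-north k i j) (≡.cong (_+ 0) (quarterSum-from-se k i j))) ⟩
    q-via-nw k i j + (q-via-north k i j + (q-via-se k i j + 0)) ∎
    where open ≡.≡-Reasoning

  q-vanishes : ∀ k i j → k < i + j → q k i j ≡ 0
  q-vanishes k i j k<i+j = ≡.trans (q≡quarterSum-indicator k i j)
    (≡.trans (walkSum-local k 0 0 (onℕ² (indicator i j)) (λ _ → 0) unreachable) (walkSum-0 k origin))
    where
    unreachable : ∀ a b → a + b ≤ k → indicator i j a b ≡ 0
    unreachable a b a+b≤k with a ℕ.≟ i | b ℕ.≟ j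
    ... | yes refl | yes refl = ⊥-elim (ℕP.<-irrefl refl (ℕP.<-≤-trans k<i+j a+b≤k))
    ... | no a≢i   | _        = indicator-off i j a b (inj₁ a≢i)
    ... | yes _    | no b≢j   = indicator-off i j a b (inj₂ b≢j)

  Σℕ< : ℕ → (ℕ → ℕ) → ℕ
  Σℕ< zero    f = 0
  Σℕ< (suc n) f = Σℕ< n f + f n

  Σℕ<-cong : ∀ n {f g} → (∀ k → f k ≡ g k) → Σℕ< n f ≡ Σℕ< n g
  Σℕ<-cong zero    f≡g = refl
  Σℕ<-cong (suc n) f≡g = ≡.cong₂ _+_ (Σℕ<-cong n f≡g) (f≡g n)

  Σℕ<-zero : ∀ n f → (∀ k → k < n → f k ≡ 0) → Σℕ< n f ≡ 0
  Σℕ<-zero zero    f _   = refl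
  Σℕ<-zero (suc n) f f≡0 = ≡.cong₂ _+_ (Σℕ<-zero n f (λ k k<n → f≡0 k (ℕP.m<n⇒m<1+n k<n))) (f≡0 n (ℕP.n<1+n n))

  Σℕ<-single : ∀ n m f → m < n → (∀ k → k ≢ m → f k ≡ 0) → Σℕ< n f ≡ f m
  Σℕ<-single (suc n) m f m<1+n others with m ℕ.≟ n
  ... | yes refl = ≡.cong (_+ f m) (Σℕ<-zero n f (λ k k<n → others k (ℕP.<⇒≢ k<n)))
  ... | no m≢n   = ≡.trans (≡.cong₂ _+_ (Σℕ<-single n m f (ℕP.≤∧≢⇒< (ℕP.≤-pred m<1+n) m≢n) others) (others n (m≢n ∘ ≡.sym)))
                           (ℕP.+-identityʳ (f m))

  quarterSum-Σℕ< : ∀ k n (g : ℕ → ℕ → ℕ → ℕ) → quarterSum k (λ a b → Σℕ< n (λ i → g i a b)) ≡ Σℕ< n (λ i → quarterSum k (g i))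
  quarterSum-Σℕ< k zero    g = quarterSum-0 k
  quarterSum-Σℕ< k (suc n) g = ≡.trans (quarterSum-+ k (λ a b → Σℕ< n (λ i → g i a b)) (g n)) (≡.cong (_+ quarterSum k (g n)) (quarterSum-Σℕ< k n g))

  length-qpWalks : ∀ k L → k < L → length (qpWalks k) ≡ Σℕ< L (λ i → Σℕ< L (λ j → q k i j))
  length-qpWalks k L k<L = begin
    length (qpWalks k)
      ≡⟨ length-filter (staysIn? origin) (allWalks k) ⟩
    walkSum k origin (λ _ → 1)
      ≡⟨ walkSum-local k 0 0 (λ _ → 1) (onℕ² (λ a b → Σℕ< L (λ i → Σℕ< L (λ j → indicator i j a b)))) (λ a b a+b≤k → ≡.sym (one-hit a b a+b≤k)) ⟩
    quarterSum k (λ a b → Σℕ< L (λ i → Σℕ< L (λ j → indicator i j a b)))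
      ≡⟨ quarterSum-Σℕ< k L (λ i a b → Σℕ< L (λ j → indicator i j a b)) ⟩
    Σℕ< L (λ i → quarterSum k (λ a b → Σℕ< L (λ j → indicator i j a b)))
      ≡⟨ Σℕ<-cong L (λ i → ≡.trans (quarterSum-Σℕ< k L (λ j → indicator i j)) (Σℕ<-cong L (λ j → ≡.sym (q≡quarterSum-indicator k i j)))) ⟩
    Σℕ< L (λ i → Σℕ< L (λ j → q k i j)) ∎
    where
    open ≡.≡-Reasoning
    one-hit : ∀ a b → a + b ≤ k → Σℕ< L (λ i → Σℕ< L (λ j → indicator i j a b)) ≡ 1
    one-hit a b a+b≤k = ≡.trans
      (Σℕ<-single L a _ (ℕP.≤-<-trans (ℕP.m≤m+n a b) (ℕP.≤-<-trans a+b≤k k<L))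
        (λ i i≢a → Σℕ<-zero L _ (λ j _ → indicator-off i j a b (inj₁ (i≢a ∘ ≡.sym)))))
      (≡.trans (Σℕ<-single L b _ (ℕP.≤-<-trans (ℕP.m≤n+m b a) (ℕP.≤-<-trans a+b≤k k<L))
        (λ j j≢b → indicator-off a j a b (inj₂ (j≢b ∘ ≡.sym))))
      (indicator-cong (≡.cong₂ _∧_ (==-refl a) (==-refl b))))

-- The functional equation

Coefficients : Set
Coefficients = ℕ → ℕ → ℤ

eval₂ : ℕ → ℕ → Coefficients → Ser → Ser → Ser
eval₂ Li Lj a u v = Σₛ Li (λ i → Σₛ Lj (λ j → a i j · ((u ^^ i) ⊗ (v ^^ j))))

shiftˣ shiftʸ onlyˣ⁰ onlyʸ⁰ : Coefficients → Coefficients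
shiftˣ a zero    j = + 0
shiftˣ a (suc i) j = a i j
shiftʸ a i zero    = + 0
shiftʸ a i (suc j) = a i j
onlyˣ⁰ a zero    j = a 0 j
onlyˣ⁰ a (suc i) j = + 0
onlyʸ⁰ a i zero    = a i 0
onlyʸ⁰ a i (suc j) = + 0

eval₂-cong : ∀ Li Lj {a b} u v → (∀ i j → a i j ≡ b i j) → eval₂ Li Lj a u v ≈ eval₂ Li Lj b u v
eval₂-cong Li Lj u v a≡b = Σₛ-cong Li (λ i → Σₛ-cong Lj (λ j → ·-cong (a≡b i j) (≈-refl {(u ^^ i) ⊗ (v ^^ j)})))

eval₂-+ : ∀ Li Lj a b u v → eval₂ Li Lj (λ i j → a i j ℤ.+ b i j) u v ≈ eval₂ Li Lj a u v ⊕ eval₂ Li Lj b u v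
eval₂-+ Li Lj a b u v = ≈-trans
  (Σₛ-cong Li (λ i → ≈-trans (Σₛ-cong Lj (λ j → coeffs (λ n m → ℤP.*-distribʳ-+ (((u ^^ i) ⊗ (v ^^ j)) n m) (a i j) (b i j))))
                             (Σₛ-⊕ Lj (λ j → a i j · ((u ^^ i) ⊗ (v ^^ j))) (λ j → b i j · ((u ^^ i) ⊗ (v ^^ j))))))
  (Σₛ-⊕ Li (λ i → Σₛ Lj (λ j → a i j · ((u ^^ i) ⊗ (v ^^ j)))) (λ i → Σₛ Lj (λ j → b i j · ((u ^^ i) ⊗ (v ^^ j)))))

eval₂-neg : ∀ Li Lj a u v → eval₂ Li Lj (λ i j → ℤ.- a i j) u v ≈ neg (eval₂ Li Lj a u v)
eval₂-neg Li Lj a u v = ≈-trans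
  (Σₛ-cong Li (λ i → ≈-trans (Σₛ-cong Lj (λ j → coeffs (λ n m → ≡.sym (ℤP.neg-distribˡ-* (a i j) (((u ^^ i) ⊗ (v ^^ j)) n m)))))
                             (≈-sym (neg-distrib-Σₛ Lj (λ j → a i j · ((u ^^ i) ⊗ (v ^^ j)))))))
  (≈-sym (neg-distrib-Σₛ Li (λ i → Σₛ Lj (λ j → a i j · ((u ^^ i) ⊗ (v ^^ j))))))

eval₂-shiftˣ : ∀ Li Lj a u v → eval₂ (suc Li) Lj (shiftˣ a) u v ≈ u ⊗ eval₂ Li Lj a u v
eval₂-shiftˣ Li Lj a u v = begin
  eval₂ (suc Li) Lj (shiftˣ a) u v
    ≈⟨ Σₛ-head Li (λ i → Σₛ Lj (λ j → shiftˣ a i j · ((u ^^ i) ⊗ (v ^^ j)))) ⟩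
  Σₛ Lj (λ j → (+ 0) · (one ⊗ (v ^^ j))) ⊕ Σₛ Li (λ i → Σₛ Lj (λ j → a i j · ((u ^^ suc i) ⊗ (v ^^ j))))
    ≈⟨ ⊕-cong (Σₛ-zero Lj _ (λ j _ → ·-zero (one ⊗ (v ^^ j)))) (Σₛ-cong Li (λ i → ≈-trans (Σₛ-cong Lj (λ j → pull i j))
         (≈-sym (⊗-distribˡ-Σₛ Lj u (λ j → a i j · ((u ^^ i) ⊗ (v ^^ j))))))) ⟩
  zeroS ⊕ Σₛ Li (λ i → u ⊗ Σₛ Lj (λ j → a i j · ((u ^^ i) ⊗ (v ^^ j))))
    ≈⟨ ⊕-identityˡ _ ⟩
  Σₛ Li (λ i → u ⊗ Σₛ Lj (λ j → a i j · ((u ^^ i) ⊗ (v ^^ j))))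
    ≈⟨ ⊗-distribˡ-Σₛ Li u (λ i → Σₛ Lj (λ j → a i j · ((u ^^ i) ⊗ (v ^^ j)))) ⟨
  u ⊗ eval₂ Li Lj a u v ∎
  where
  open ≈-Reasoning
  pull : ∀ i j → a i j · ((u ^^ suc i) ⊗ (v ^^ j)) ≈ u ⊗ (a i j · ((u ^^ i) ⊗ (v ^^ j)))
  pull i j = ≈-trans (·-congʳ (a i j) (⊗-assoc u (u ^^ i) (v ^^ j))) (≈-sym (⊗-· (a i j) u ((u ^^ i) ⊗ (v ^^ j))))

eval₂-shiftʸ : ∀ Li Lj a u v → eval₂ Li (suc Lj) (shiftʸ a) u v ≈ v ⊗ eval₂ Li Lj a u v
eval₂-shiftʸ Li Lj a u v = ≈-trans (Σₛ-cong Li row) (≈-sym (⊗-distribˡ-Σₛ Li v (λ i → Σₛ Lj (λ j → a i j · ((u ^^ i) ⊗ (v ^^ j))))))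
  where
  open ≈-Reasoning
  pull : ∀ i j → a i j · ((u ^^ i) ⊗ (v ^^ suc j)) ≈ v ⊗ (a i j · ((u ^^ i) ⊗ (v ^^ j)))
  pull i j = ≈-trans (·-congʳ (a i j) (solve 3 (λ x y z → x :* (y :* z) := y :* (x :* z)) ≈-refl (u ^^ i) v (v ^^ j)))
                     (≈-sym (⊗-· (a i j) v ((u ^^ i) ⊗ (v ^^ j))))
  row : ∀ i → Σₛ (suc Lj) (λ j → shiftʸ a i j · ((u ^^ i) ⊗ (v ^^ j))) ≈ v ⊗ Σₛ Lj (λ j → a i j · ((u ^^ i) ⊗ (v ^^ j)))
  row i = begin
    Σₛ (suc Lj) (λ j → shiftʸ a i j · ((u ^^ i) ⊗ (v ^^ j)))
      ≈⟨ Σₛ-head Lj (λ j → shiftʸ a i j · ((u ^^ i) ⊗ (v ^^ j))) ⟩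
    ((+ 0) · ((u ^^ i) ⊗ one)) ⊕ Σₛ Lj (λ j → a i j · ((u ^^ i) ⊗ (v ^^ suc j)))
      ≈⟨ ⊕-cong (·-zero ((u ^^ i) ⊗ one)) (Σₛ-cong Lj (pull i)) ⟩
    zeroS ⊕ Σₛ Lj (λ j → v ⊗ (a i j · ((u ^^ i) ⊗ (v ^^ j))))
      ≈⟨ ⊕-identityˡ _ ⟩
    Σₛ Lj (λ j → v ⊗ (a i j · ((u ^^ i) ⊗ (v ^^ j))))
      ≈⟨ ⊗-distribˡ-Σₛ Lj v (λ j → a i j · ((u ^^ i) ⊗ (v ^^ j))) ⟨
    v ⊗ Σₛ Lj (λ j → a i j · ((u ^^ i) ⊗ (v ^^ j))) ∎

SupportedIn : ℕ → ℕ → Coefficients → Set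
SupportedIn Mi Mj a = ∀ i j → (Mi ≤ i → a i j ≡ + 0) × (Mj ≤ j → a i j ≡ + 0)

eval₂-truncate : ∀ Mi Mj Li Lj a u v → SupportedIn Mi Mj a → Mi ≤ Li → Mj ≤ Lj → eval₂ Li Lj a u v ≈ eval₂ Mi Mj a u v
eval₂-truncate Mi Mj Li Lj a u v supp Mi≤Li Mj≤Lj = ≈-trans
  (Σₛ-truncate Mi Li _ Mi≤Li (λ i Mi≤i _ → Σₛ-zero Lj _ (λ j _ → vanish i j (proj₁ (supp i j) Mi≤i))))
  (Σₛ-cong Mi (λ i → Σₛ-truncate Mj Lj _ Mj≤Lj (λ j Mj≤j _ → vanish i j (proj₂ (supp i j) Mj≤j))))
  where
  vanish : ∀ i j → a i j ≡ + 0 → a i j · ((u ^^ i) ⊗ (v ^^ j)) ≈ zeroS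
  vanish i j a≡0 = ≈-trans (·-cong a≡0 (≈-refl {(u ^^ i) ⊗ (v ^^ j)})) (·-zero ((u ^^ i) ⊗ (v ^^ j)))

eval₂-onlyˣ⁰ : ∀ Li Lj a u v → eval₂ (suc Li) Lj (onlyˣ⁰ a) u v ≈ Σₛ Lj (λ j → a 0 j · (v ^^ j))
eval₂-onlyˣ⁰ Li Lj a u v = ≈-trans (Σₛ-head Li _) (≈-trans
  (⊕-cong (Σₛ-cong Lj (λ j → ·-congʳ (a 0 j) (⊗-identityˡ (v ^^ j))))
          (Σₛ-zero Li _ (λ i _ → Σₛ-zero Lj _ (λ j _ → ·-zero ((u ^^ suc i) ⊗ (v ^^ j))))))
  (⊕-identityʳ _))

eval₂-onlyʸ⁰ : ∀ Li Lj a u v → eval₂ Li (suc Lj) (onlyʸ⁰ a) u v ≈ Σₛ Li (λ i → a i 0 · (u ^^ i))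
eval₂-onlyʸ⁰ Li Lj a u v = Σₛ-cong Li (λ i → ≈-trans (Σₛ-head Lj _) (≈-trans
  (⊕-cong (·-congʳ (a i 0) (⊗-identityʳ (u ^^ i))) (Σₛ-zero Lj _ (λ j _ → ·-zero ((u ^^ i) ⊗ (v ^^ suc j)))))
  (⊕-identityʳ _)))

walkCoefficients : ℕ → Coefficients
walkCoefficients k i j = + q k i j

Q-poly : ℕ → Ser → Ser → Ser
Q-poly k u v = eval₂ (suc k) (suc k) (walkCoefficients k) u v

Q-poly-x0 : ℕ → Ser → Ser
Q-poly-x0 k u = Σₛ (suc k) (λ i → walkCoefficients k i 0 · (u ^^ i))

Q-poly-0y : ℕ → Ser → Ser
Q-poly-0y k v = Σₛ (suc k) (λ j → walkCoefficients k 0 j · (v ^^ j))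

-- The last-step recurrence for q as an identity of coefficient arrays:
-- uv·Q_{k+1} = (uv² + u² + v²)·Q_k − v²·Q_k(0,v) − u²·Q_k(u,0).
step-coefficients : ℕ → Coefficients
step-coefficients k i j =
  (shiftˣ (shiftʸ (shiftʸ Aₖ)) i j ℤ.+ (shiftˣ (shiftˣ Aₖ) i j ℤ.+ shiftʸ (shiftʸ Aₖ) i j))
  ℤ.+ ℤ.- shiftʸ (shiftʸ (onlyˣ⁰ Aₖ)) i j ℤ.+ ℤ.- shiftˣ (shiftˣ (onlyʸ⁰ Aₖ)) i j
  where Aₖ = walkCoefficients k

module _ where
  open ℤ-Solver using (solve-∀)

  step-coefficients-correct : ∀ k i j → shiftˣ (shiftʸ (walkCoefficients (suc k))) i j ≡ step-coefficients k i j
  step-coefficients-correct k zero j = ≡.sym (≡.trans (≡.cong (λ y → (+ 0 ℤ.+ (+ 0 ℤ.+ Y)) ℤ.+ ℤ.- y ℤ.+ ℤ.- + 0) (same j)) (cancel Y))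
    where
    Y = shiftʸ (shiftʸ (walkCoefficients k)) 0 j
    same : ∀ j → shiftʸ (shiftʸ (onlyˣ⁰ (walkCoefficients k))) 0 j ≡ shiftʸ (shiftʸ (walkCoefficients k)) 0 j
    same zero          = refl
    same (suc zero)    = refl
    same (suc (suc j)) = refl
    cancel : ∀ (Y : ℤ) → (+ 0 ℤ.+ (+ 0 ℤ.+ Y)) ℤ.+ ℤ.- Y ℤ.+ ℤ.- + 0 ≡ + 0
    cancel = solve-∀
  step-coefficients-correct k (suc i) zero = ≡.sym (≡.trans (≡.cong (λ x → (+ 0 ℤ.+ (X ℤ.+ + 0)) ℤ.+ ℤ.- + 0 ℤ.+ ℤ.- x) (same i)) (cancel X))
    where
    X = shiftˣ (shiftˣ (walkCoefficients k)) (suc i) 0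
    same : ∀ i → shiftˣ (shiftˣ (onlyʸ⁰ (walkCoefficients k))) (suc i) 0 ≡ shiftˣ (shiftˣ (walkCoefficients k)) (suc i) 0
    same zero    = refl
    same (suc i) = refl
    cancel : ∀ (X : ℤ) → (+ 0 ℤ.+ (X ℤ.+ + 0)) ℤ.+ ℤ.- + 0 ℤ.+ ℤ.- X ≡ + 0
    cancel = solve-∀
  step-coefficients-correct k (suc i) (suc j) = begin
    + q (suc k) i j
      ≡⟨ ≡.cong +_ (q-suc k i j) ⟩
    + (q-via-nw k i j ℕ.+ (q-via-north k i j ℕ.+ (q-via-se k i j ℕ.+ 0)))
      ≡⟨ ≡.trans (ℤP.pos-+ (q-via-nw k i j) _) (≡.cong (λ z → + q-via-nw k i j ℤ.+ z)
           (≡.trans (ℤP.pos-+ (q-via-north k i j) _) (≡.cong (λ z → + q-via-north k i j ℤ.+ z) (ℤP.pos-+ (q-via-se k i j) 0)))) ⟩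
    + q-via-nw k i j ℤ.+ (+ q-via-north k i j ℤ.+ (+ q-via-se k i j ℤ.+ + 0))
      ≡⟨ reorder (+ q-via-nw k i j) (+ q-via-north k i j) (+ q-via-se k i j) ⟩
    (+ q-via-north k i j ℤ.+ (+ q-via-se k i j ℤ.+ + q-via-nw k i j)) ℤ.+ ℤ.- + 0 ℤ.+ ℤ.- + 0
      ≡⟨ ≡.cong₂ (λ x y → x ℤ.+ ℤ.- y ℤ.+ ℤ.- + 0) (≡.cong₂ ℤ._+_ (via-north j) (≡.cong₂ ℤ._+_ (via-se i) (via-nw j))) (no-x0 j) ⟩
    (shiftʸ Aₖ i j ℤ.+ (shiftˣ Aₖ i (suc j) ℤ.+ shiftʸ Aₖ (suc i) j)) ℤ.+ ℤ.- shiftʸ (onlyˣ⁰ Aₖ) (suc i) j ℤ.+ ℤ.- + 0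
      ≡⟨ ≡.cong (λ y → (shiftʸ Aₖ i j ℤ.+ (shiftˣ Aₖ i (suc j) ℤ.+ shiftʸ Aₖ (suc i) j)) ℤ.+ ℤ.- shiftʸ (onlyˣ⁰ Aₖ) (suc i) j ℤ.+ ℤ.- y) (no-0y i) ⟩
    step-coefficients k (suc i) (suc j) ∎
    where
    open ≡.≡-Reasoning
    Aₖ = walkCoefficients k
    reorder : ∀ (a b c : ℤ) → a ℤ.+ (b ℤ.+ (c ℤ.+ + 0)) ≡ (b ℤ.+ (c ℤ.+ a)) ℤ.+ ℤ.- + 0 ℤ.+ ℤ.- + 0
    reorder = solve-∀
    via-north : ∀ j → + q-via-north k i j ≡ shiftʸ Aₖ i j
    via-north zero    = refl
    via-north (suc j) = refl
    via-se : ∀ i → + q-via-se k i j ≡ shiftˣ Aₖ i (suc j)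
    via-se zero    = refl
    via-se (suc i) = refl
    via-nw : ∀ j → + q-via-nw k i j ≡ shiftʸ Aₖ (suc i) j
    via-nw zero    = refl
    via-nw (suc j) = refl
    no-x0 : ∀ j → + 0 ≡ shiftʸ (onlyˣ⁰ Aₖ) (suc i) j
    no-x0 zero    = refl
    no-x0 (suc j) = refl
    no-0y : ∀ i → + 0 ≡ shiftˣ (onlyʸ⁰ Aₖ) i (suc j)
    no-0y zero    = refl
    no-0y (suc i) = refl

walkCoefficients-supported : ∀ k → SupportedIn (suc k) (suc k) (walkCoefficients k)
walkCoefficients-supported k i j =
  (λ k<i → ≡.cong +_ (q-vanishes k i j (ℕP.<-≤-trans k<i (ℕP.m≤m+n i j)))) ,
  (λ k<j → ≡.cong +_ (q-vanishes k i j (ℕP.<-≤-trans k<j (ℕP.m≤n+m j i))))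

module _ (k : ℕ) (u v : Ser) where

  private
    Aₖ : Coefficients
    Aₖ = walkCoefficients k

    E : Coefficients → Ser
    E a = eval₂ (4 ℕ.+ k) (4 ℕ.+ k) a u v

    supp = walkCoefficients-supported k

    north-terms : E (shiftˣ (shiftʸ (shiftʸ Aₖ))) ≈ u ⊗ (v ⊗ (v ⊗ Q-poly k u v))
    north-terms = ≈-trans (eval₂-shiftˣ (3 ℕ.+ k) (4 ℕ.+ k) _ u v) (⊗-congˡ u (≈-trans (eval₂-shiftʸ (3 ℕ.+ k) (3 ℕ.+ k) _ u v) (⊗-congˡ v
      (≈-trans (eval₂-shiftʸ (3 ℕ.+ k) (2 ℕ.+ k) Aₖ u v) (⊗-congˡ v
        (eval₂-truncate (suc k) (suc k) (3 ℕ.+ k) (2 ℕ.+ k) Aₖ u v supp (ℕP.m≤n+m _ 2) (ℕP.m≤n+m _ 1)))))))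

    south-east-terms : E (shiftˣ (shiftˣ Aₖ)) ≈ u ⊗ (u ⊗ Q-poly k u v)
    south-east-terms = ≈-trans (eval₂-shiftˣ (3 ℕ.+ k) (4 ℕ.+ k) _ u v) (⊗-congˡ u (≈-trans (eval₂-shiftˣ (2 ℕ.+ k) (4 ℕ.+ k) Aₖ u v) (⊗-congˡ u
      (eval₂-truncate (suc k) (suc k) (2 ℕ.+ k) (4 ℕ.+ k) Aₖ u v supp (ℕP.m≤n+m _ 1) (ℕP.m≤n+m _ 3)))))

    north-west-terms : E (shiftʸ (shiftʸ Aₖ)) ≈ v ⊗ (v ⊗ Q-poly k u v)
    north-west-terms = ≈-trans (eval₂-shiftʸ (4 ℕ.+ k) (3 ℕ.+ k) _ u v) (⊗-congˡ v (≈-trans (eval₂-shiftʸ (4 ℕ.+ k) (2 ℕ.+ k) Aₖ u v) (⊗-congˡ v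
      (eval₂-truncate (suc k) (suc k) (4 ℕ.+ k) (2 ℕ.+ k) Aₖ u v supp (ℕP.m≤n+m _ 3) (ℕP.m≤n+m _ 1)))))

    y-axis-terms : E (shiftʸ (shiftʸ (onlyˣ⁰ Aₖ))) ≈ v ⊗ (v ⊗ Q-poly-0y k v)
    y-axis-terms = ≈-trans (eval₂-shiftʸ (4 ℕ.+ k) (3 ℕ.+ k) _ u v) (⊗-congˡ v (≈-trans (eval₂-shiftʸ (4 ℕ.+ k) (2 ℕ.+ k) (onlyˣ⁰ Aₖ) u v) (⊗-congˡ v
      (≈-trans (eval₂-onlyˣ⁰ (3 ℕ.+ k) (2 ℕ.+ k) Aₖ u v) (Σₛ-truncate (suc k) (2 ℕ.+ k) _ (ℕP.n≤1+n _)
        (λ j k<j _ → ≈-trans (·-cong (proj₂ (supp 0 j) k<j) (≈-refl {v ^^ j})) (·-zero (v ^^ j))))))))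

    x-axis-terms : E (shiftˣ (shiftˣ (onlyʸ⁰ Aₖ))) ≈ u ⊗ (u ⊗ Q-poly-x0 k u)
    x-axis-terms = ≈-trans (eval₂-shiftˣ (3 ℕ.+ k) (4 ℕ.+ k) _ u v) (⊗-congˡ u (≈-trans (eval₂-shiftˣ (2 ℕ.+ k) (4 ℕ.+ k) (onlyʸ⁰ Aₖ) u v) (⊗-congˡ u
      (≈-trans (eval₂-onlyʸ⁰ (2 ℕ.+ k) (3 ℕ.+ k) Aₖ u v) (Σₛ-truncate (suc k) (2 ℕ.+ k) _ (ℕP.n≤1+n _)
        (λ i k<i _ → ≈-trans (·-cong (proj₁ (supp i 0) k<i) (≈-refl {u ^^ i})) (·-zero (u ^^ i))))))))

  eval₂-step-coefficients : eval₂ (4 ℕ.+ k) (4 ℕ.+ k) (step-coefficients k) u v ≈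
    (((u ⊗ (v ⊗ (v ⊗ Q-poly k u v))) ⊕ ((u ⊗ (u ⊗ Q-poly k u v)) ⊕ (v ⊗ (v ⊗ Q-poly k u v))))
      ⊕ neg (v ⊗ (v ⊗ Q-poly-0y k v))) ⊕ neg (u ⊗ (u ⊗ Q-poly-x0 k u))
  eval₂-step-coefficients =
    ≈-trans (eval₂-+ L L (λ i j → N i j ℤ.+ (SE i j ℤ.+ NW i j) ℤ.+ ℤ.- Y i j) (λ i j → ℤ.- X i j) u v) (⊕-cong
      (≈-trans (eval₂-+ L L (λ i j → N i j ℤ.+ (SE i j ℤ.+ NW i j)) (λ i j → ℤ.- Y i j) u v) (⊕-cong
        (≈-trans (eval₂-+ L L N (λ i j → SE i j ℤ.+ NW i j) u v)
                 (⊕-cong north-terms (≈-trans (eval₂-+ L L SE NW u v) (⊕-cong south-east-terms north-west-terms))))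
        (≈-trans (eval₂-neg L L Y u v) (neg-cong y-axis-terms))))
      (≈-trans (eval₂-neg L L X u v) (neg-cong x-axis-terms)))
    where
    L  = 4 ℕ.+ k
    N  = shiftˣ (shiftʸ (shiftʸ Aₖ))
    SE = shiftˣ (shiftˣ Aₖ)
    NW = shiftʸ (shiftʸ Aₖ)
    Y  = shiftʸ (shiftʸ (onlyˣ⁰ Aₖ))
    X  = shiftˣ (shiftˣ (onlyʸ⁰ Aₖ))

Q-poly-step : ∀ k u v → u ⊗ (v ⊗ Q-poly (suc k) u v) ≈
  (((u ⊗ (v ⊗ (v ⊗ Q-poly k u v))) ⊕ ((u ⊗ (u ⊗ Q-poly k u v)) ⊕ (v ⊗ (v ⊗ Q-poly k u v))))
    ⊕ neg (v ⊗ (v ⊗ Q-poly-0y k v))) ⊕ neg (u ⊗ (u ⊗ Q-poly-x0 k u))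
Q-poly-step k u v = begin
  u ⊗ (v ⊗ Q-poly (suc k) u v)
    ≈⟨ ⊗-congˡ u (⊗-congˡ v (eval₂-truncate (2 ℕ.+ k) (2 ℕ.+ k) (3 ℕ.+ k) (3 ℕ.+ k) Aₖ₊₁ u v
                              (walkCoefficients-supported (suc k)) (ℕP.n≤1+n _) (ℕP.n≤1+n _))) ⟨
  u ⊗ (v ⊗ eval₂ (3 ℕ.+ k) (3 ℕ.+ k) Aₖ₊₁ u v)
    ≈⟨ ⊗-congˡ u (eval₂-shiftʸ (3 ℕ.+ k) (3 ℕ.+ k) Aₖ₊₁ u v) ⟨
  u ⊗ eval₂ (3 ℕ.+ k) (4 ℕ.+ k) (shiftʸ Aₖ₊₁) u v
    ≈⟨ eval₂-shiftˣ (3 ℕ.+ k) (4 ℕ.+ k) (shiftʸ Aₖ₊₁) u v ⟨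
  eval₂ (4 ℕ.+ k) (4 ℕ.+ k) (shiftˣ (shiftʸ Aₖ₊₁)) u v
    ≈⟨ eval₂-cong (4 ℕ.+ k) (4 ℕ.+ k) u v (step-coefficients-correct k) ⟩
  eval₂ (4 ℕ.+ k) (4 ℕ.+ k) (step-coefficients k) u v
    ≈⟨ eval₂-step-coefficients k u v ⟩
  (((u ⊗ (v ⊗ (v ⊗ Q-poly k u v))) ⊕ ((u ⊗ (u ⊗ Q-poly k u v)) ⊕ (v ⊗ (v ⊗ Q-poly k u v))))
    ⊕ neg (v ⊗ (v ⊗ Q-poly-0y k v))) ⊕ neg (u ⊗ (u ⊗ Q-poly-x0 k u)) ∎
  where
  open ≈-Reasoning
  Aₖ₊₁ = walkCoefficients (suc k)

Q-at : Ser → Ser → Ser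
Q-at u v = Σ∞ (λ k → (tvar ^^ k) ⊗ Q-poly k u v)

Q-at-x0 : Ser → Ser
Q-at-x0 u = Σ∞ (λ k → (tvar ^^ k) ⊗ Q-poly-x0 k u)

Q-at-0y : Ser → Ser
Q-at-0y v = Σ∞ (λ k → (tvar ^^ k) ⊗ Q-poly-0y k v)

Fx : Ser → Ser
Fx u = (tvar ⊗ (u ⊗ u)) ⊗ Q-at-x0 u

Gy : Ser → Ser
Gy v = (tvar ⊗ (v ⊗ v)) ⊗ Q-at-0y v

Q-poly-0 : ∀ u v → Q-poly 0 u v ≈ one
Q-poly-0 u v = ≈-trans (⊕-identityˡ _) (≈-trans (⊕-identityˡ _) (≈-trans (·-identity (one ⊗ one)) (⊗-identityˡ one)))

functional-equation : ∀ u v → K u v ⊗ Q-at u v ≈ ((u ⊗ v) ⊕ neg (Fx u)) ⊕ neg (Gy v)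
functional-equation u v = kernel-equation tvar u v (Q-at u v) (Fx u) (Gy v) (begin
  (u ⊗ v) ⊗ Q-at u v
    ≈⟨ ⊗-congˡ (u ⊗ v) (Σ∞-head TQ (λ k → Ord≥-t^⊗ k (Q-poly k u v))) ⟩
  (u ⊗ v) ⊗ (TQ 0 ⊕ Σ∞ (λ k → TQ (suc k)))
    ≈⟨ ⊗-distribˡ (u ⊗ v) (TQ 0) (Σ∞ (λ k → TQ (suc k))) ⟩
  ((u ⊗ v) ⊗ TQ 0) ⊕ ((u ⊗ v) ⊗ Σ∞ (λ k → TQ (suc k)))
    ≈⟨ ⊕-cong (≈-trans (⊗-congˡ (u ⊗ v) (≈-trans (⊗-identityˡ (Q-poly 0 u v)) (Q-poly-0 u v))) (⊗-identityʳ (u ⊗ v)))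
              (⊗-distribˡ-Σ∞ (λ k → TQ (suc k)) (λ k → Ord≥-weaken (TQ (suc k)) (ℕP.n≤1+n k) (Ord≥-t^⊗ (suc k) (Q-poly (suc k) u v))) (u ⊗ v)) ⟩
  (u ⊗ v) ⊕ Σ∞ (λ k → (u ⊗ v) ⊗ TQ (suc k))
    ≈⟨ ⊕-congˡ (u ⊗ v) (Σ∞-cong (λ k → scaled-step tvar (tvar ^^ k) u v (Q-poly k u v) (Q-poly (suc k) u v) (Q-poly-x0 k u) (Q-poly-0y k v)
                                         (Q-poly-step k u v))) ⟩
  (u ⊗ v) ⊕ Σ∞ (λ k → (((tvar ⊗ W) ⊗ TQ k) ⊕ neg ((tvar ⊗ (u ⊗ u)) ⊗ TF k)) ⊕ neg ((tvar ⊗ (v ⊗ v)) ⊗ TG k))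
    ≈⟨ ⊕-congˡ (u ⊗ v) (≈-trans (Σ∞-⊕ _ _) (⊕-cong (≈-trans (Σ∞-⊕ _ _) (⊕-cong
         (≈-sym (⊗-distribˡ-Σ∞ TQ (λ k → Ord≥-t^⊗ k (Q-poly k u v)) (tvar ⊗ W)))
         (≈-trans (Σ∞-neg _) (neg-cong (≈-sym (⊗-distribˡ-Σ∞ TF (λ k → Ord≥-t^⊗ k (Q-poly-x0 k u)) (tvar ⊗ (u ⊗ u))))))))
         (≈-trans (Σ∞-neg _) (neg-cong (≈-sym (⊗-distribˡ-Σ∞ TG (λ k → Ord≥-t^⊗ k (Q-poly-0y k v)) (tvar ⊗ (v ⊗ v)))))))) ⟩
  (u ⊗ v) ⊕ ((((tvar ⊗ W) ⊗ Q-at u v) ⊕ neg (Fx u)) ⊕ neg (Gy v)) ∎)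
  where
  open ≈-Reasoning
  W = (u ⊗ (v ⊗ v)) ⊕ ((u ⊗ u) ⊕ (v ⊗ v))
  TQ TF TG : ℕ → Ser
  TQ k = (tvar ^^ k) ⊗ Q-poly k u v
  TF k = (tvar ^^ k) ⊗ Q-poly-x0 k u
  TG k = (tvar ^^ k) ⊗ Q-poly-0y k v

-- Alternating sums

Converges-resp : ∀ {P L L′} → L ≈ L′ → Converges P L → Converges P L′
Converges-resp L≈L′ conv n i with conv n i
... | M , eventually = M , λ m M≤m → ≡.trans (eventually m M≤m) (coeff L≈L′ n i)

even-suc : ∀ m → even (suc m) ≡ not (even m)
even-suc zero    = refl
even-suc (suc m) = ≡.trans (≡.sym (not-involutive (even m))) (≡.cong not (≡.sym (even-suc m)))

module AlternatingTelescope
  (f g Φ Ψ : Ser → Ser) (S : ℕ → Ser)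
  (S-suc  : ∀ m → S (suc m) ≡ (if even m then f (S m) else g (S m)))
  (split-f : ∀ x → x ⊗ f x ≈ Φ x ⊕ Ψ (f x))
  (split-g : ∀ x → x ⊗ g x ≈ Ψ x ⊕ Φ (g x))
  (Ord≥-f : ∀ m x → Ord≥ m x → Ord≥ (suc m) (f x)) (Ord≥-g : ∀ m x → Ord≥ m x → Ord≥ (suc m) (g x))
  (Ord≥-Φ : ∀ m x → Ord≥ m x → Ord≥ m (Φ x))       (Ord≥-Ψ : ∀ m x → Ord≥ m x → Ord≥ m (Ψ x))
  where

  step : Bool → Ser → Ser
  step b x = if b then f x else g x

  signed : Bool → Ser → Ser
  signed b x = if b then x else neg x

  remainder : Bool → Ser → Ser
  remainder b x = if b then Φ x else neg (Ψ x)

  increment : ∀ b x → signed b (x ⊗ step b x) ≈ remainder b x ⊕ neg (remainder (not b) (step b x))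
  increment true  x = ≈-trans (split-f x) (⊕-congˡ (Φ x) (solve 1 (λ y → y := :- (:- y)) ≈-refl (Ψ (f x))))
  increment false x = ≈-trans (neg-cong (split-g x)) (solve 2 (λ y z → :- (y :+ z) := :- y :+ :- z) ≈-refl (Ψ x) (Φ (g x)))

  altPartial-suc : ∀ m → altPartial S (suc m) ≈ altPartial S m ⊕ signed (even m) (S m ⊗ S (suc m))
  altPartial-suc m with even m
  ... | true  = ≈-refl
  ... | false = ≈-refl

  partial-sum : ∀ m → altPartial S m ≈ Φ (S 0) ⊕ neg (remainder (even m) (S m))
  partial-sum zero    = ≈-sym (neg-inverseʳ (Φ (S 0)))
  partial-sum (suc m) = begin
    altPartial S (suc m)
      ≈⟨ altPartial-suc m ⟩
    altPartial S m ⊕ signed (even m) (S m ⊗ S (suc m))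
      ≈⟨ ⊕-cong (partial-sum m) (≈-trans (≈-reflexive (≡.cong (λ y → signed (even m) (S m ⊗ y)) (S-suc m))) (increment (even m) (S m))) ⟩
    (Φ (S 0) ⊕ neg r) ⊕ (r ⊕ neg (remainder (not (even m)) (step (even m) (S m))))
      ≈⟨ solve 3 (λ a r r′ → (a :+ :- r) :+ (r :+ :- r′) := a :+ :- r′) ≈-refl (Φ (S 0)) r (remainder (not (even m)) (step (even m) (S m))) ⟩
    Φ (S 0) ⊕ neg (remainder (not (even m)) (step (even m) (S m)))
      ≈⟨ ≈-reflexive (≡.cong₂ (λ b y → Φ (S 0) ⊕ neg (remainder b y)) (≡.sym (even-suc m)) (≡.sym (S-suc m))) ⟩
    Φ (S 0) ⊕ neg (remainder (even (suc m)) (S (suc m))) ∎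
    where
    open ≈-Reasoning
    r = remainder (even m) (S m)

  Ord≥-S : ∀ m → Ord≥ m (S m)
  Ord≥-S zero    = Ord≥-zero (S 0)
  Ord≥-S (suc m) = ≡.subst (Ord≥ (suc m)) (≡.sym (S-suc m)) (by-parity (even m))
    where
    by-parity : ∀ b → Ord≥ (suc m) (step b (S m))
    by-parity true  = Ord≥-f m (S m) (Ord≥-S m)
    by-parity false = Ord≥-g m (S m) (Ord≥-S m)

  Ord≥-remainder : ∀ m → Ord≥ m (remainder (even m) (S m))
  Ord≥-remainder m = by-parity (even m)
    where
    by-parity : ∀ b → Ord≥ m (remainder b (S m))
    by-parity true  = Ord≥-Φ m (S m) (Ord≥-S m)
    by-parity false = Ord≥-neg (Ψ (S m)) (Ord≥-Ψ m (S m) (Ord≥-S m))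

  converges : Converges (altPartial S) (Φ (S 0))
  converges n i = suc n , λ m n<m → ≡.trans (coeff (partial-sum m) n i)
    (≡.trans (≡.cong (λ z → Φ (S 0) n i ℤ.+ ℤ.- z) (Ord≥-remainder m n i n<m)) (ℤP.+-identityʳ (Φ (S 0) n i)))

K-root⇒split : ∀ u v → K u v ≈ zeroS → u ⊗ v ≈ Fx u ⊕ Gy v
K-root⇒split u v K≈0 = kernel-root⇒product-split tvar u v (Q-at u v) (Fx u) (Gy v) K≈0 (functional-equation u v)

split-Y₁ : ∀ G → G ⊗ Y₁ G ≈ Fx G ⊕ Gy (Y₁ G)
split-Y₁ G = K-root⇒split G (Y₁ G) (K-Y₁ G)

split-X₁ : ∀ v → v ⊗ X₁ v ≈ Gy v ⊕ Fx (X₁ v)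
split-X₁ v = ≈-trans (⊗-comm v (X₁ v)) (≈-trans (K-root⇒split (X₁ v) v (K-X₁ v)) (⊕-comm (Fx (X₁ v)) (Gy v)))

Ord≥-Y₁ : ∀ m G → Ord≥ m G → Ord≥ (suc m) (Y₁ G)
Ord≥-Y₁ m G ord = Ord≥-resp (≈-sym (Y₁-closed-form G))
  (Ord≥-tvar-⊗ (G ⊗ Cat ((tvar ⊗ tvar) ⊗ (one ⊕ G))) (Ord≥-⊗ˡ G (Cat ((tvar ⊗ tvar) ⊗ (one ⊕ G))) ord))

Ord≥-X₁ : ∀ m v → Ord≥ m v → Ord≥ (suc m) (X₁ v)
Ord≥-X₁ m v ord = Ord≥-resp (≈-sym (X₁-closed-form v)) (Ord≥-weaken (v ⊗ (τ v ⊗ Cat (τ v ⊗ τ v))) (ℕP.≤-reflexive (ℕP.+-comm 1 m))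
  (Ord≥-⊗ v (τ v ⊗ Cat (τ v ⊗ τ v)) ord (Ord≥-⊗ˡ (τ v) (Cat (τ v ⊗ τ v)) (Ord≥1-tvar⊗ (Geo (tvar ⊗ v))))))

Ord≥-Fx : ∀ m u → Ord≥ m u → Ord≥ m (Fx u)
Ord≥-Fx m u ord = Ord≥-⊗ˡ (tvar ⊗ (u ⊗ u)) (Q-at-x0 u) (Ord≥-⊗ʳ tvar (u ⊗ u) (Ord≥-⊗ˡ u u ord))

Ord≥-Gy : ∀ m v → Ord≥ m v → Ord≥ m (Gy v)
Ord≥-Gy m v ord = Ord≥-⊗ˡ (tvar ⊗ (v ⊗ v)) (Q-at-0y v) (Ord≥-⊗ʳ tvar (v ⊗ v) (Ord≥-⊗ˡ v v ord))

alternating-sum-A : ∀ c → Converges (altPartial (A c)) (Fx c)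
alternating-sum-A c = AlternatingTelescope.converges Y₁ X₁ Fx Gy (A c) (λ _ → refl) split-Y₁ split-X₁ Ord≥-Y₁ Ord≥-X₁ Ord≥-Fx Ord≥-Gy

alternating-sum-B : ∀ c → Converges (altPartial (B c)) (Gy c)
alternating-sum-B c = AlternatingTelescope.converges X₁ Y₁ Gy Fx (B c) (λ _ → refl) split-X₁ split-Y₁ Ord≥-X₁ Ord≥-Y₁ Ord≥-Gy Ord≥-Fx

Q-at-x0-zvar : Q-at-x0 zvar ≈ Qx0
Q-at-x0-zvar = ≈-trans (Σ∞-cong (λ k → t^⊗Σz^ k (suc k) (λ i → walkCoefficients k i 0)))
  (Σ∞-monomials Qx0 (λ k i k<i → ≡.cong +_ (q-vanishes k i 0 (ℕP.<-≤-trans k<i (ℕP.m≤m+n i 0)))))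

Q-at-0y-zvar : Q-at-0y zvar ≈ Q0y
Q-at-0y-zvar = ≈-trans (Σ∞-cong (λ k → t^⊗Σz^ k (suc k) (λ j → walkCoefficients k 0 j)))
  (Σ∞-monomials Q0y (λ k j k<j → ≡.cong +_ (q-vanishes k 0 j k<j)))

zvar^2 : zvar ^^ 2 ≈ zvar ⊗ zvar
zvar^2 = ⊗-congˡ zvar (⊗-identityʳ zvar)

Fx-zvar : Fx zvar ≈ (zvar ^^ 2) ⊗ (tvar ⊗ Qx0)
Fx-zvar = ≈-trans (⊗-congˡ (tvar ⊗ (zvar ⊗ zvar)) Q-at-x0-zvar)
  (≈-trans (solve 3 (λ t z Q → (t :* (z :* z)) :* Q := (z :* z) :* (t :* Q)) ≈-refl tvar zvar Qx0)
           (⊗-congʳ (tvar ⊗ Qx0) (≈-sym zvar^2)))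

Gy-zvar : Gy zvar ≈ (zvar ^^ 2) ⊗ (tvar ⊗ Q0y)
Gy-zvar = ≈-trans (⊗-congˡ (tvar ⊗ (zvar ⊗ zvar)) Q-at-0y-zvar)
  (≈-trans (solve 3 (λ t z Q → (t :* (z :* z)) :* Q := (z :* z) :* (t :* Q)) ≈-refl tvar zvar Q0y)
           (⊗-congʳ (tvar ⊗ Q0y) (≈-sym zvar^2)))

+Σℕ< : ∀ L f → + Σℕ< L f ≡ Σ< L (λ i → + f i)
+Σℕ< zero    f = refl
+Σℕ< (suc L) f = ≡.trans (ℤP.pos-+ (Σℕ< L f) (f L)) (≡.cong (ℤ._+ + f L) (+Σℕ< L f))

walk-total : ∀ k → Σ< (suc k) (λ i → Σ< (suc k) (λ j → walkCoefficients k i j)) ≡ Q11 k 0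
walk-total k = ≡.sym (≡.trans (≡.cong +_ (length-qpWalks k (suc k) (ℕP.n<1+n k)))
  (≡.trans (+Σℕ< (suc k) _) (Σ<-cong (suc k) (λ i → +Σℕ< (suc k) (λ j → q k i j)))))

Q-poly-one : ∀ k → Q-poly k one one ≈ Q11 k 0 · one
Q-poly-one k = begin
  Q-poly k one one
    ≈⟨ Σₛ-cong (suc k) (λ i → Σₛ-cong (suc k) (λ j → ·-congʳ (walkCoefficients k i j) (≈-trans (⊗-cong (one^^ i) (one^^ j)) (⊗-identityˡ one)))) ⟩
  Σₛ (suc k) (λ i → Σₛ (suc k) (λ j → walkCoefficients k i j · one))
    ≈⟨ Σₛ-cong (suc k) (λ i → Σₛ-· (suc k) (walkCoefficients k i) one) ⟩
  Σₛ (suc k) (λ i → Σ< (suc k) (walkCoefficients k i) · one)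
    ≈⟨ Σₛ-· (suc k) (λ i → Σ< (suc k) (walkCoefficients k i)) one ⟩
  Σ< (suc k) (λ i → Σ< (suc k) (walkCoefficients k i)) · one
    ≈⟨ ·-cong (walk-total k) (≈-refl {one}) ⟩
  Q11 k 0 · one ∎
  where open ≈-Reasoning

Q-at-one : Q-at one one ≈ Q11
Q-at-one = ≈-trans (Σ∞-cong term) (Σ∞-monomials Q11 (λ { k zero () ; k (suc i) _ → refl }))
  where
  term : ∀ k → (tvar ^^ k) ⊗ Q-poly k one one ≈ Σₛ (suc k) (λ i → Q11 k i · mono k i)
  term k = ≈-trans (⊗-congˡ (tvar ^^ k) (Q-poly-one k)) (≈-trans (⊗-· (Q11 k 0) (tvar ^^ k) one)
    (≈-trans (·-congʳ (Q11 k 0) (≈-trans (⊗-identityʳ (tvar ^^ k)) (≈-sym (mono≈t^ k))))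
    (≈-sym (≈-trans (Σₛ-head k _) (≈-trans (⊕-congˡ (Q11 k 0 · mono k 0) (Σₛ-zero k _ (λ i _ → ·-zero (mono k (suc i)))))
                                           (⊕-identityʳ (Q11 k 0 · mono k 0)))))))

K-one-one : K one one ≈ one ⊖ ((+ 3) · tvar)
K-one-one = ≈-trans (kernel-at-1# tvar) (⊕-congˡ one (neg-cong (≈-trans (⊗-comm tvar (one ⊕ (one ⊕ one)))
  (≈-trans (⊗-congʳ tvar three) (≈-sym (·≈const⊗ (+ 3) tvar))))))
  where
  open ℤ-Solver using (solve-∀)
  triple : ∀ (x : ℤ) → x ℤ.+ (x ℤ.+ x) ≡ + 3 ℤ.* x
  triple = solve-∀
  three : one ⊕ (one ⊕ one) ≈ const (+ 3)
  three = coeffs (λ n i → triple (one n i))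

Q11-equation : (one ⊖ ((+ 3) · tvar)) ⊗ Q11 ≈ (one ⊖ Fx one) ⊖ Gy one
Q11-equation = begin
  (one ⊖ ((+ 3) · tvar)) ⊗ Q11                   ≈⟨ ⊗-cong (≈-sym K-one-one) (≈-sym Q-at-one) ⟩
  K one one ⊗ Q-at one one                       ≈⟨ functional-equation one one ⟩
  ((one ⊗ one) ⊕ neg (Fx one)) ⊕ neg (Gy one)    ≈⟨ ⊕-congʳ (neg (Gy one)) (⊕-congʳ (neg (Fx one)) (⊗-identityˡ one)) ⟩
  (one ⊖ Fx one) ⊖ Gy one                        ∎
  where open ≈-Reasoning

theorem4 : Converges (altPartial (A zvar)) ((zvar ^^ 2) ⊗ (tvar ⊗ Qx0))
    × Converges (altPartial (B zvar)) ((zvar ^^ 2) ⊗ (tvar ⊗ Q0y))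
    × (Σ[ SA ∈ Ser ] Σ[ SB ∈ Ser ]
         Converges (altPartial (A one)) SA
         × Converges (altPartial (B one)) SB
         × (∀ n i → ((one ⊖ ((+ 3) · tvar)) ⊗ Q11) n i ≡ ((one ⊖ SA) ⊖ SB) n i))
theorem4 = Converges-resp Fx-zvar (alternating-sum-A zvar)
         , Converges-resp Gy-zvar (alternating-sum-B zvar)
         , Fx one , Gy one
         , alternating-sum-A one , alternating-sum-B one
         , coeff Q11-equation
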